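{- Let $T=(V,E)$ be a tree and let $u,v\in V$ with $d(u,v)\ge 2$. The inequality $x_{uv}\le x_{u,\vec u(v)}+x_{\vec u(v),v}$ defines a facet of $\mathrm{LMC}(T)$ if and only if $d(u,v)=2$.
   Context: For a tree $T=(V,E)$ and distinct $u,v\in V$, $d(u,v)$ is the length of the unique $uv$-path $P_{uv}$ in $T$; if $d(u,v)\ge 2$, $\vec u(v)$ denotes the neighbor of $u$ on $P_{uv}$. Edges of $T$ are identified with pairs in $\binom{V}{2}$. A decomposition of $T$ is a partition of $V$ each of whose blocks induces a connected subtree; for such a decomposition, its lifted multicut is the set of pairs $ab\in\binom{V}{2}$ with $a,b$ in distinct blocks. $\mathrm{LMC}(T)\subseteq\mathbb{R}^{\binom{V}{2}}$ is the convex hull of the characteristic vectors of these lifted multicuts over all decompositions of $T$.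
   Formalization: $\mathrm{LMC}(T)$ is taken over ℚ rather than ℝ, as the set of its points with rational coordinates, so validity of the inequality and the dimensions of the polytope and its face concern these points. -}

module Defs where

open import Data.Nat using (ℕ; zero; suc)
open import Data.Fin using (Fin; zero; suc; _≟_)
open import Data.Bool using (Bool; true; false)
open import Data.List using (List; []; _∷_)
open import Data.List.Relation.Unary.Unique.Propositional using (Unique)
open import Data.Product using (Σ; ∃; _×_; _,_)
open import Data.Unit using (⊤)
open import Relation.Nullary using (¬_; yes; no)
open import Relation.Binary.PropositionalEquality using (_≡_; _≢_)
import Data.Rational as Q
open Q using (ℚ; 0ℚ; 1ℚ)

record Graph (n : ℕ) : Set where
  field
    adj     : Fin n → Fin n → Bool
    adj-sym : ∀ a b → adj a b ≡ adj b a
    adj-irr : ∀ a → adj a a ≡ false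
open Graph public

data Chain {n} (G : Graph n) : List (Fin n) → Set where
  single : ∀ x → Chain G (x ∷ [])
  cons   : ∀ x y rest → adj G x y ≡ true → Chain G (y ∷ rest) → Chain G (x ∷ y ∷ rest)

data Last {A : Set} : List A → A → Set where
  last-one  : ∀ x → Last (x ∷ []) x
  last-cons : ∀ x y ys z → Last (y ∷ ys) z → Last (x ∷ y ∷ ys) z

record IsPath {n} (G : Graph n) (a b : Fin n) (xs : List (Fin n)) : Set where
  field
    chain  : Chain G xs
    start  : Σ (List (Fin n)) λ ys → xs ≡ a ∷ ys
    end    : Last xs b
    unique : Unique xs

IsTree : ∀ {n} → Graph n → Set
IsTree {n} G =
  (∀ a b → ∃ λ xs → IsPath G a b xs) ×
  (∀ a b xs ys → IsPath G a b xs → IsPath G a b ys → xs ≡ ys)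

-- Decompositions: vertex labelling whose blocks induce connected subtrees

data WalkIn {n} (G : Graph n) (P : Fin n → Set) : Fin n → Fin n → Set where
  here : ∀ a → P a → WalkIn G P a a
  step : ∀ a c b → P a → adj G a c ≡ true → WalkIn G P c b → WalkIn G P a b

record Decomposition {n} (G : Graph n) : Set where
  field
    label     : Fin n → Fin n
    connected : ∀ a b → label a ≡ label b →
                WalkIn G (λ c → label c ≡ label a) a b
open Decomposition public

-- Vectors in ℚ^(V choose 2), represented as symmetric functions
-- Fin n → Fin n → ℚ (entry (a,b) = entry (b,a) = coordinate of pair ab;
-- diagonal is 0 for all points considered).

QVec : ℕ → Set
QVec n = Fin n → Fin n → ℚ

χ : ∀ {n} {G : Graph n} → Decomposition G → QVec n
χ D a b with label D a ≟ label D b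
... | yes _ = 0ℚ
... | no  _ = 1ℚ

Σ[_] : ∀ k → (Fin k → ℚ) → ℚ
Σ[ zero  ] f = 0ℚ
Σ[ suc k ] f = f zero Q.+ Σ[ k ] (λ i → f (suc i))

InLMC : ∀ {n} → Graph n → QVec n → Set
InLMC {n} G x =
  Σ ℕ λ k → Σ (Fin k → ℚ) λ w → Σ (Fin k → Decomposition G) λ D →
    (∀ i → 0ℚ Q.≤ w i) × (Σ[ k ] w ≡ 1ℚ) ×
    (∀ a b → x a b ≡ Σ[ k ] (λ i → w i Q.* χ (D i) a b))

AffIndep : ∀ {n k} → (Fin k → QVec n) → Set
AffIndep {n} {k} y =
  ∀ (λ' : Fin k → ℚ) → Σ[ k ] λ' ≡ 0ℚ →
  (∀ a b → Σ[ k ] (λ i → λ' i Q.* y i a b) ≡ 0ℚ) →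
  ∀ i → λ' i ≡ 0ℚ

-- the maximal number of affinely independent points of S is r
-- (i.e. dim S = r - 1)
AffRank : ∀ {n} → (QVec n → Set) → ℕ → Set
AffRank {n} S r =
  (Σ (Fin r → QVec n) λ y → (∀ i → S (y i)) × AffIndep y) ×
  (∀ (y : Fin (suc r) → QVec n) → (∀ i → S (y i)) → ¬ AffIndep y)

DefinesFacet : ∀ {n} → (QVec n → Set) → (QVec n → ℚ) → ℚ → Set
DefinesFacet {n} P α β =
  (∀ x → P x → α x Q.≤ β) ×
  Σ ℕ λ r → AffRank P (suc r) × AffRank (λ x → P x × α x ≡ β) r

-- Every lifted multicut satisfies the triangle inequality x_uv ≤ x_uw + x_wv, hence so does LMC(T).
-- Affine ranks are bounded by counting coordinates: the pairs ab together with the constant 1 for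
-- LMC(T), and all pairs but uv on the face, where x_uv = x_uw + x_wv is determined by the others.
-- If d(u,v) = 2 both bounds are attained by explicit lifted multicuts, whose independence follows
-- from a triangular system of affine tests. If d(u,v) ≥ 3, let w₂ follow w on the path: a block
-- containing w and v contains w₂, so the face also satisfies x_uw₂ = x_uw + x_ww₂ and has
-- codimension at least two.

module Submission where

open import Defs
open import Data.Bool using (true)
open import Data.Empty using (⊥; ⊥-elim)
open import Data.Fin as Fin using (Fin; zero; suc; punchIn)
import Data.Fin.Properties as Finₚ
import Data.Integer as ℤ
open import Data.List using (List; []; _∷_; length; _++_; reverse; filter; cartesianProduct; allFin; lookup; map)
import Data.List.Properties as Listₚ
open import Data.List.Membership.Propositional using (_∈_; _∉_)
open import Data.List.Membership.Propositional.Properties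
  using (∈-∃++; ∈-++⁻; ∈-++⁺ˡ; ∈-++⁺ʳ; ∈-length; ∈-lookup; ∈-filter⁺; ∈-filter⁻; ∈-allFin; ∈-cartesianProduct⁺)
open import Data.List.Relation.Unary.All as All using (All; []; _∷_)
import Data.List.Relation.Unary.All.Properties as Allₚ
open import Data.List.Relation.Unary.AllPairs using ([]; _∷_)
open import Data.List.Relation.Unary.Any using (here; there; toSum)
import Data.List.Relation.Unary.Any.Properties as Anyₚ
open import Data.List.Relation.Unary.Unique.Propositional using (Unique)
import Data.List.Relation.Unary.Unique.Propositional.Properties as Uniqueₚ
open import Data.Maybe using (Maybe; just; nothing)
open import Data.Nat as ℕ using (ℕ; zero; suc; _∸_; _⊔_; s≤s; z≤n)
import Data.Nat.Properties as ℕₚ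
open import Data.Product using (Σ; _×_; _,_; proj₁; proj₂; ∃)
open import Data.Product.Properties using (≡-dec)
open import Data.Rational as ℚ using (ℚ; 0ℚ; 1ℚ; _+_; _*_; _-_; -_; _≤_; 1/_; NonZero; NonNegative)
import Data.Rational.Properties as ℚₚ
open import Data.Rational.Solver using (module +-*-Solver)
open import Data.Sum using (_⊎_; inj₁; inj₂; [_,_]′)
import Data.Sum as ⊎
open import Data.Vec.Functional using (insertAt) renaming (_∷_ to _∷ᶠ_)
open import Data.Vec.Functional.Properties using (insertAt-lookup; insertAt-punchIn)
open import Function using (_∘_)
open import Function.Bundles using (_⇔_; mk⇔)
open import Relation.Binary using (tri<; tri≈; tri>)
open import Relation.Binary.PropositionalEquality
open import Relation.Nullary using (¬_; Dec; yes; no; ¬?)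
open import Relation.Nullary.Decidable using (decidable-stable; _⊎-dec_)
open +-*-Solver using (solve; _:+_; _:-_; _:*_; :-_; _:=_; con)


-- Finite sums and linear algebra over ℚ

Σ-cong : ∀ k {f g : Fin k → ℚ} → (∀ i → f i ≡ g i) → Σ[ k ] f ≡ Σ[ k ] g
Σ-cong zero    f≗g = refl
Σ-cong (suc k) f≗g = cong₂ _+_ (f≗g zero) (Σ-cong k (λ i → f≗g (suc i)))

Σ-zero : ∀ k → Σ[ k ] (λ _ → 0ℚ) ≡ 0ℚ
Σ-zero zero    = refl
Σ-zero (suc k) = cong (0ℚ +_) (Σ-zero k)

Σ-+ : ∀ k (f g : Fin k → ℚ) → Σ[ k ] (λ i → f i + g i) ≡ Σ[ k ] f + Σ[ k ] g
Σ-+ zero    f g = refl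
Σ-+ (suc k) f g = trans (cong (f zero + g zero +_) (Σ-+ k (λ i → f (suc i)) (λ i → g (suc i))))
  (solve 4 (λ a b c d → (a :+ b) :+ (c :+ d) := (a :+ c) :+ (b :+ d)) refl (f zero) (g zero) _ _)

Σ-neg : ∀ k (f : Fin k → ℚ) → Σ[ k ] (λ i → - f i) ≡ - Σ[ k ] f
Σ-neg zero    f = refl
Σ-neg (suc k) f = trans (cong (- f zero +_) (Σ-neg k (λ i → f (suc i))))
  (sym (ℚₚ.neg-distrib-+ (f zero) _))

Σ-- : ∀ k (f g : Fin k → ℚ) → Σ[ k ] (λ i → f i - g i) ≡ Σ[ k ] f - Σ[ k ] g
Σ-- k f g = trans (Σ-+ k f (λ i → - g i)) (cong (Σ[ k ] f +_) (Σ-neg k g))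

Σ-*ˡ : ∀ k (c : ℚ) (f : Fin k → ℚ) → Σ[ k ] (λ i → c * f i) ≡ c * Σ[ k ] f
Σ-*ˡ zero    c f = sym (ℚₚ.*-zeroʳ c)
Σ-*ˡ (suc k) c f = trans (cong (c * f zero +_) (Σ-*ˡ k c (λ i → f (suc i))))
  (sym (ℚₚ.*-distribˡ-+ c (f zero) _))

Σ-*ʳ : ∀ k (c : ℚ) (f : Fin k → ℚ) → Σ[ k ] (λ i → f i * c) ≡ Σ[ k ] f * c
Σ-*ʳ k c f = trans (Σ-cong k (λ i → ℚₚ.*-comm (f i) c)) (trans (Σ-*ˡ k c f) (ℚₚ.*-comm c _))

Σ-*-- : ∀ k (μ f g : Fin k → ℚ) →
        Σ[ k ] (λ j → μ j * (f j - g j)) ≡ Σ[ k ] (λ j → μ j * f j) - Σ[ k ] (λ j → μ j * g j)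
Σ-*-- k μ f g = trans (Σ-cong k (λ j → solve 3 (λ m x y → m :* (x :- y) := m :* x :- m :* y) refl (μ j) (f j) (g j)))
                      (Σ-- k _ _)

Σ-punchIn : ∀ m (f : Fin (suc m) → ℚ) j → Σ[ suc m ] f ≡ f j + Σ[ m ] (λ i → f (punchIn j i))
Σ-punchIn m       f zero    = refl
Σ-punchIn (suc m) f (suc j) = trans (cong (f zero +_) (Σ-punchIn m (λ i → f (suc i)) j))
  (solve 3 (λ a b c → a :+ (b :+ c) := b :+ (a :+ c)) refl (f zero) (f (suc j)) _)

Σ-single : ∀ k (f : Fin k → ℚ) i → (∀ j → j ≢ i → f j ≡ 0ℚ) → Σ[ k ] f ≡ f i
Σ-single (suc k) f i f≡0 = begin
  Σ[ suc k ] f                               ≡⟨ Σ-punchIn k f i ⟩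
  f i + Σ[ k ] (λ j → f (punchIn i j))       ≡⟨ cong (f i +_) (Σ-cong k (λ j → f≡0 _ (Finₚ.punchInᵢ≢i i j))) ⟩
  f i + Σ[ k ] (λ _ → 0ℚ)                    ≡⟨ cong (f i +_) (Σ-zero k) ⟩
  f i + 0ℚ                                   ≡⟨ ℚₚ.+-identityʳ (f i) ⟩
  f i                                        ∎
  where open ≡-Reasoning

Σ-nonpos : ∀ k (f : Fin k → ℚ) → (∀ i → f i ≤ 0ℚ) → Σ[ k ] f ≤ 0ℚ
Σ-nonpos zero    f f≤0 = ℚₚ.≤-refl
Σ-nonpos (suc k) f f≤0 = ℚₚ.+-mono-≤ (f≤0 zero) (Σ-nonpos k (λ i → f (suc i)) (λ i → f≤0 (suc i)))

nonPos+nonPos≡0⇒≡0 : ∀ {p q} → p ≤ 0ℚ → q ≤ 0ℚ → p + q ≡ 0ℚ → p ≡ 0ℚ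
nonPos+nonPos≡0⇒≡0 {p} {q} p≤0 q≤0 p+q≡0 = ℚₚ.≤-antisym p≤0 (subst (0ℚ ≤_) (sym p≡-q) (ℚₚ.neg-antimono-≤ q≤0))
  where
    p≡-q : p ≡ - q
    p≡-q = trans (solve 2 (λ p q → p := (p :+ q) :- q) refl p q)
                 (trans (cong (_- q) p+q≡0) (ℚₚ.+-identityˡ (- q)))

Σ-nonpos-zero : ∀ k (f : Fin k → ℚ) → (∀ i → f i ≤ 0ℚ) → Σ[ k ] f ≡ 0ℚ → ∀ i → f i ≡ 0ℚ
Σ-nonpos-zero (suc k) f f≤0 Σf≡0 = λ where
    zero    → f0≡0
    (suc i) → Σ-nonpos-zero k (λ i → f (suc i)) (λ i → f≤0 (suc i)) rest≡0 i
  where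
    rest : ℚ
    rest = Σ[ k ] (λ i → f (suc i))
    f0≡0 : f zero ≡ 0ℚ
    f0≡0 = nonPos+nonPos≡0⇒≡0 (f≤0 zero) (Σ-nonpos k (λ i → f (suc i)) (λ i → f≤0 (suc i))) Σf≡0
    rest≡0 : rest ≡ 0ℚ
    rest≡0 = trans (sym (ℚₚ.+-identityˡ rest)) (trans (cong (_+ rest) (sym f0≡0)) Σf≡0)

nonNeg*nonPos≤0 : ∀ {p q} → 0ℚ ≤ p → q ≤ 0ℚ → p * q ≤ 0ℚ
nonNeg*nonPos≤0 {p} {q} p≥0 q≤0 = ℚₚ.≤-trans (ℚₚ.*-monoˡ-≤-nonNeg p q≤0) (ℚₚ.≤-reflexive (ℚₚ.*-zeroʳ p))
  where instance _ : NonNegative p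
                 _ = ℚ.nonNegative p≥0

p*q≡0⇒p≡0 : ∀ p q → q ≢ 0ℚ → p * q ≡ 0ℚ → p ≡ 0ℚ
p*q≡0⇒p≡0 p q q≢0 pq≡0 = begin
  p                 ≡⟨ sym (ℚₚ.*-identityʳ p) ⟩
  p * 1ℚ            ≡⟨ cong (p *_) (sym (ℚₚ.*-inverseʳ q)) ⟩
  p * (q * 1/ q)    ≡⟨ sym (ℚₚ.*-assoc p q _) ⟩
  (p * q) * 1/ q    ≡⟨ cong (_* 1/ q) pq≡0 ⟩
  0ℚ * 1/ q         ≡⟨ ℚₚ.*-zeroˡ (1/ q) ⟩
  0ℚ                ∎
  where
    open ≡-Reasoning
    instance _ : NonZero q
             _ = ℚ.≢-nonZero q≢0

lincomb : ∀ {k} {C : Set} → (Fin k → ℚ) → (Fin k → C → ℚ) → C → ℚ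
lincomb {k} μ v c = Σ[ k ] (λ i → μ i * v i c)

lincomb-insertAt : ∀ {C : Set} {m} (v : Fin (suc m) → C → ℚ) j (μ s : Fin m → ℚ) c →
  lincomb (insertAt μ j (- Σ[ m ] (λ i → μ i * s i))) v c ≡
  lincomb μ (λ i c → v (punchIn j i) c - s i * v j c) c
lincomb-insertAt {m = m} v j μ s c = begin
  lincomb μ′ v c                              ≡⟨ Σ-punchIn m (λ i → μ′ i * v i c) j ⟩
  μ′ j * v j c + Σ[ m ] (λ i → μ′ (punchIn j i) * v (punchIn j i) c)
    ≡⟨ cong₂ (λ x t → x * v j c + t) (insertAt-lookup μ j _)
             (Σ-cong m (λ i → cong (_* v (punchIn j i) c) (insertAt-punchIn μ j _ i))) ⟩
  - S * v j c + A                             ≡⟨ solve 3 (λ a s x → (:- s) :* x :+ a := a :- s :* x) refl A S (v j c) ⟩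
  A - S * v j c                               ≡⟨ cong (λ t → A - t) (sym (Σ-*ʳ m (v j c) (λ i → μ i * s i))) ⟩
  A - Σ[ m ] (λ i → μ i * s i * v j c)        ≡⟨ sym (Σ-- m _ _) ⟩
  Σ[ m ] (λ i → μ i * v (punchIn j i) c - μ i * s i * v j c)
    ≡⟨ Σ-cong m (λ i → solve 4 (λ m x s y → m :* x :- m :* s :* y := m :* (x :- s :* y)) refl (μ i) _ (s i) (v j c)) ⟩
  lincomb μ (λ i c → v (punchIn j i) c - s i * v j c) c ∎
  where
    open ≡-Reasoning
    S A : ℚ
    S = Σ[ m ] (λ i → μ i * s i)
    A = Σ[ m ] (λ i → μ i * v (punchIn j i) c)
    μ′ : Fin (suc m) → ℚ
    μ′ = insertAt μ j (- S)

pivot-cancels : ∀ x p .{{_ : NonZero p}} → x - (x * 1/ p) * p ≡ 0ℚ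
pivot-cancels x p = begin
  x - (x * 1/ p) * p   ≡⟨ cong (λ t → x - t) (ℚₚ.*-assoc x (1/ p) p) ⟩
  x - x * (1/ p * p)   ≡⟨ cong (λ t → x - x * t) (ℚₚ.*-inverseˡ p) ⟩
  x - x * 1ℚ           ≡⟨ cong (λ t → x - t) (ℚₚ.*-identityʳ x) ⟩
  x - x                ≡⟨ ℚₚ.+-inverseʳ x ⟩
  0ℚ                   ∎
  where open ≡-Reasoning

eliminate : ∀ {C : Set} {m} (v : Fin (suc m) → C → ℚ) j c .{{_ : NonZero (v j c)}} → Fin m → C → ℚ
eliminate v j c i c′ = v (punchIn j i) c′ - (v (punchIn j i) c * 1/ v j c) * v j c′

-- Gaussian elimination: a coordinate on which some vector is nonzero is cleared using it as pivot.
fewer-coordinates⇒dependent : ∀ {C : Set} (cs : List C) {k} (v : Fin k → C → ℚ) → length cs ℕ.< k →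
  ∃ λ (μ : Fin k → ℚ) → (∃ λ i → μ i ≢ 0ℚ) × All (λ c → lincomb μ v c ≡ 0ℚ) cs
fewer-coordinates⇒dependent [] {suc k} v _ = (λ { zero → 1ℚ ; (suc _) → 0ℚ }) , (zero , λ ()) , []
fewer-coordinates⇒dependent (c ∷ cs) {suc m} v (s≤s |cs|<m) with Finₚ.any? (λ j → ¬? (v j c ℚ.≟ 0ℚ))
... | no no-pivot with fewer-coordinates⇒dependent cs v (ℕₚ.m<n⇒m<1+n |cs|<m)
...   | μ , nontrivial , rest = μ , nontrivial , column≡0 ∷ rest
  where
    v·c≡0 : ∀ i → v i c ≡ 0ℚ
    v·c≡0 i = decidable-stable (v i c ℚ.≟ 0ℚ) (λ v·c≢0 → no-pivot (i , v·c≢0))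
    column≡0 : lincomb μ v c ≡ 0ℚ
    column≡0 = trans (Σ-cong (suc m) (λ i → trans (cong (μ i *_) (v·c≡0 i)) (ℚₚ.*-zeroʳ (μ i))))
                     (Σ-zero (suc m))
fewer-coordinates⇒dependent (c ∷ cs) {suc m} v (s≤s |cs|<m)
  | yes (j , pivot≢0) with fewer-coordinates⇒dependent cs (eliminate v j c {{ℚ.≢-nonZero pivot≢0}}) |cs|<m
...   | μ , (i , μi≢0) , rest =
        insertAt μ j (- S) , (punchIn j i , μ′≢0) , column≡0 ∷ All.map (trans (lincomb-insertAt v j μ s _)) rest
  where
    instance _ = ℚ.≢-nonZero pivot≢0
    s : Fin m → ℚ
    s i = v (punchIn j i) c * 1/ v j c
    S : ℚ
    S = Σ[ m ] (λ i → μ i * s i)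
    μ′≢0 : insertAt μ j (- S) (punchIn j i) ≢ 0ℚ
    μ′≢0 = μi≢0 ∘ trans (sym (insertAt-punchIn μ j (- S) i))
    column≡0 : lincomb (insertAt μ j (- S)) v c ≡ 0ℚ
    column≡0 = begin
      lincomb (insertAt μ j (- S)) v c     ≡⟨ lincomb-insertAt v j μ s c ⟩
      lincomb μ (eliminate v j c) c
        ≡⟨ Σ-cong m (λ i → cong (μ i *_) (pivot-cancels (v (punchIn j i) c) (v j c))) ⟩
      Σ[ m ] (λ i → μ i * 0ℚ)              ≡⟨ Σ-cong m (λ i → ℚₚ.*-zeroʳ (μ i)) ⟩
      Σ[ m ] (λ _ → 0ℚ)                    ≡⟨ Σ-zero m ⟩
      0ℚ                                   ∎
      where open ≡-Reasoning

max[_] : ∀ k → (Fin k → ℕ) → ℕ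
max[ zero  ] f = 0
max[ suc k ] f = f zero ⊔ max[ k ] (λ i → f (suc i))

≤max : ∀ k (f : Fin k → ℕ) i → f i ℕ.≤ max[ k ] f
≤max (suc k) f zero    = ℕₚ.m≤m⊔n (f zero) _
≤max (suc k) f (suc i) = ℕₚ.≤-trans (≤max k (λ i → f (suc i)) i) (ℕₚ.m≤n⊔m (f zero) _)

-- Downward induction on the ranking ρ: off-diagonal entries of row i only meet higher-ranked μ j.
triangular⇒trivial : ∀ k (g : Fin k → Fin k → ℚ) (ρ : Fin k → ℕ) →
  (∀ i → g i i ≢ 0ℚ) → (∀ i j → g i j ≢ 0ℚ → j ≡ i ⊎ ρ i ℕ.< ρ j) →
  ∀ (μ : Fin k → ℚ) → (∀ i → Σ[ k ] (λ j → μ j * g i j) ≡ 0ℚ) → ∀ i → μ i ≡ 0ℚ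
triangular⇒trivial k g ρ diagonal≢0 triangular μ rows≡0 i = μ≡0 (suc (M ∸ ρ i)) i ℕₚ.≤-refl
  where
    M : ℕ
    M = max[ k ] ρ
    μ≡0 : ∀ t i → M ∸ ρ i ℕ.< t → μ i ≡ 0ℚ
    μ≡0 (suc t) i (s≤s M∸ρi≤t) =
      p*q≡0⇒p≡0 (μ i) (g i i) (diagonal≢0 i) (trans (sym (Σ-single k _ i off-diagonal)) (rows≡0 i))
      where
        off-diagonal : ∀ j → j ≢ i → μ j * g i j ≡ 0ℚ
        off-diagonal j j≢i with g i j ℚ.≟ 0ℚ
        ... | yes gij≡0 = trans (cong (μ j *_) gij≡0) (ℚₚ.*-zeroʳ (μ j))
        ... | no gij≢0 with triangular i j gij≢0
        ...   | inj₁ j≡i   = ⊥-elim (j≢i j≡i)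
        ...   | inj₂ ρi<ρj = trans (cong (_* g i j) (μ≡0 t j (ℕₚ.<-≤-trans (ℕₚ.∸-monoʳ-< ρi<ρj (≤max k ρ j)) M∸ρi≤t)))
                                   (ℚₚ.*-zeroˡ (g i j))

-- Lists, paths and trees

Unordered : ∀ {A : Set} → A → A → A → A → Set
Unordered a b a′ b′ = (a ≡ a′ × b ≡ b′) ⊎ (a ≡ b′ × b ≡ a′)

unordered-swap : ∀ {A : Set} {a b x y : A} → Unordered a b x y → Unordered b a x y
unordered-swap (inj₁ (a≡x , b≡y)) = inj₂ (b≡y , a≡x)
unordered-swap (inj₂ (a≡y , b≡x)) = inj₁ (b≡x , a≡y)

unordered-trans : ∀ {A : Set} {a b a′ b′ x y : A} → Unordered a b x y → Unordered a′ b′ x y → Unordered a b a′ b′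
unordered-trans (inj₁ (refl , refl)) (inj₁ (refl , refl)) = inj₁ (refl , refl)
unordered-trans (inj₁ (refl , refl)) (inj₂ (refl , refl)) = inj₂ (refl , refl)
unordered-trans (inj₂ (refl , refl)) (inj₁ (refl , refl)) = inj₂ (refl , refl)
unordered-trans (inj₂ (refl , refl)) (inj₂ (refl , refl)) = inj₁ (refl , refl)

module _ {A : Set} where

  Unique-∷⁺ : ∀ {x : A} {xs} → x ∉ xs → Unique xs → Unique (x ∷ xs)
  Unique-∷⁺ {xs = xs} x∉xs u = Allₚ.¬Any⇒All¬ xs x∉xs ∷ u

  Unique-++⁻ʳ : ∀ (xs : List A) {ys} → Unique (xs ++ ys) → Unique ys
  Unique-++⁻ʳ []       u       = u
  Unique-++⁻ʳ (x ∷ xs) (_ ∷ u) = Unique-++⁻ʳ xs u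

  Unique-++⁻ˡ : ∀ (xs : List A) {ys} → Unique (xs ++ ys) → Unique xs
  Unique-++⁻ˡ []       u        = []
  Unique-++⁻ˡ (x ∷ xs) (x∉ ∷ u) = Allₚ.++⁻ˡ xs x∉ ∷ Unique-++⁻ˡ xs u

  Unique-reverse⁺ : ∀ {xs : List A} → Unique xs → Unique (reverse xs)
  Unique-reverse⁺ {[]}     u        = []
  Unique-reverse⁺ {x ∷ xs} (x∉ ∷ u) rewrite Listₚ.unfold-reverse x xs =
    Uniqueₚ.++⁺ (Unique-reverse⁺ u) ([] ∷ [])
      λ { (x∈ , here refl) → Allₚ.All¬⇒¬Any x∉ (Anyₚ.reverse⁻ x∈) }

  Last-∷⁻ : ∀ {x y : A} {ys z} → Last (x ∷ y ∷ ys) z → Last (y ∷ ys) z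
  Last-∷⁻ (last-cons _ _ _ _ l) = l

  Last-++⁻ : ∀ (xs : List A) {y ys z} → Last (xs ++ y ∷ ys) z → Last (y ∷ ys) z
  Last-++⁻ []           l = l
  Last-++⁻ (x ∷ [])     l = Last-∷⁻ l
  Last-++⁻ (x ∷ x′ ∷ xs) l = Last-++⁻ (x′ ∷ xs) (Last-∷⁻ l)

  Last-snoc : ∀ (xs : List A) {z} → Last (xs ++ z ∷ []) z
  Last-snoc []            = last-one _
  Last-snoc (x ∷ [])      = last-cons _ _ _ _ (last-one _)
  Last-snoc (x ∷ x′ ∷ xs) = last-cons _ _ _ _ (Last-snoc (x′ ∷ xs))

  Last-functional : ∀ {xs : List A} {z z′} → Last xs z → Last xs z′ → z ≡ z′
  Last-functional (last-one _)          (last-one _)           = refl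
  Last-functional (last-cons _ _ _ _ l) (last-cons _ _ _ _ l′) = Last-functional l l′

  Last⇒∈ : ∀ {xs : List A} {z} → Last xs z → z ∈ xs
  Last⇒∈ (last-one _)          = here refl
  Last⇒∈ (last-cons _ _ _ _ l) = there (Last⇒∈ l)

  Last-reverse : ∀ (x : A) xs → Last (reverse (x ∷ xs)) x
  Last-reverse x xs rewrite Listₚ.unfold-reverse x xs = Last-snoc (reverse xs)

  Last⇒reverse-head : ∀ {xs : List A} {z} → Last xs z → Σ (List A) λ ys → reverse xs ≡ z ∷ ys
  Last⇒reverse-head (last-one x) = [] , refl
  Last⇒reverse-head (last-cons x y ys z l) with Last⇒reverse-head l
  ... | zs , e = zs ++ x ∷ [] , trans (Listₚ.unfold-reverse x (y ∷ ys)) (cong (_++ x ∷ []) e)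

  length-snoc-≤ : ∀ (xs : List A) z ys → length (xs ++ z ∷ []) ℕ.≤ length (xs ++ z ∷ ys)
  length-snoc-≤ []       z ys = s≤s z≤n
  length-snoc-≤ (x ∷ xs) z ys = s≤s (length-snoc-≤ xs z ys)

  length-snoc-< : ∀ (xs : List A) z y ys → length (xs ++ z ∷ []) ℕ.< length (xs ++ z ∷ y ∷ ys)
  length-snoc-< []       z y ys = s≤s (s≤s z≤n)
  length-snoc-< (x ∷ xs) z y ys = s≤s (length-snoc-< xs z y ys)

  length-infix : ∀ (xs : List A) {c} mid {d} ys →
    (xs ≡ [] × ys ≡ []) ⊎ length (c ∷ mid ++ d ∷ []) ℕ.< length (xs ++ c ∷ mid ++ d ∷ ys)
  length-infix []       mid     []       = inj₁ (refl , refl)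
  length-infix []       mid {d} (y ∷ ys) = inj₂ (s≤s (length-snoc-< mid d y ys))
  length-infix (x ∷ xs) {c} mid {d} ys =
    inj₂ (s≤s (ℕₚ.≤-trans (s≤s (length-snoc-≤ mid d ys)) (Listₚ.length-++-≤ʳ (c ∷ mid ++ d ∷ ys) {xs})))

module _ {n} (G : Graph n) where

  Chain-∷⁻ : ∀ {x y} {ys} → Chain G (x ∷ y ∷ ys) → Chain G (y ∷ ys)
  Chain-∷⁻ (cons _ _ _ _ ch) = ch

  Chain-++⁻ʳ : ∀ xs {y ys} → Chain G (xs ++ y ∷ ys) → Chain G (y ∷ ys)
  Chain-++⁻ʳ []            ch = ch
  Chain-++⁻ʳ (x ∷ [])      ch = Chain-∷⁻ ch
  Chain-++⁻ʳ (x ∷ x′ ∷ xs) ch = Chain-++⁻ʳ (x′ ∷ xs) (Chain-∷⁻ ch)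

  Chain-++⁻ˡ : ∀ xs {y ys} → Chain G (xs ++ y ∷ ys) → Chain G (xs ++ y ∷ [])
  Chain-++⁻ˡ []            ch                   = single _
  Chain-++⁻ˡ (x ∷ [])      (cons _ _ _ xy ch)   = cons _ _ _ xy (single _)
  Chain-++⁻ˡ (x ∷ x′ ∷ xs) (cons _ _ _ xx′ ch)  = cons _ _ _ xx′ (Chain-++⁻ˡ (x′ ∷ xs) ch)

  Chain-snoc : ∀ {xs y z} → Chain G xs → Last xs y → adj G y z ≡ true → Chain G (xs ++ z ∷ [])
  Chain-snoc (single x)            (last-one _)          yz = cons _ _ _ yz (single _)
  Chain-snoc (cons x y rest xy ch) (last-cons _ _ _ _ l) yz = cons _ _ _ xy (Chain-snoc ch l yz)

  Chain-reverse : ∀ {xs} → Chain G xs → Chain G (reverse xs)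
  Chain-reverse (single x) = single x
  Chain-reverse (cons x y rest xy ch) rewrite Listₚ.unfold-reverse x (y ∷ rest) =
    Chain-snoc (Chain-reverse ch) (Last-reverse y rest) (trans (adj-sym G y x) xy)

  open IsPath

  IsPath-single : ∀ a → IsPath G a a (a ∷ [])
  IsPath-single a = record { chain = single a ; start = [] , refl ; end = last-one a ; unique = [] ∷ [] }

  IsPath-∷ : ∀ {x a b xs} → adj G x a ≡ true → x ∉ xs → IsPath G a b xs → IsPath G x b (x ∷ xs)
  IsPath-∷ xa x∉xs p with start p
  ... | _ , refl = record { chain = cons _ _ _ xa (chain p) ; start = _ , refl
                          ; end = last-cons _ _ _ _ (end p) ; unique = Unique-∷⁺ x∉xs (unique p) }

  IsPath-++⁻ʳ : ∀ {a b} xs {c ys} → IsPath G a b (xs ++ c ∷ ys) → IsPath G c b (c ∷ ys)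
  IsPath-++⁻ʳ xs p = record { chain = Chain-++⁻ʳ xs (chain p) ; start = _ , refl
                            ; end = Last-++⁻ xs (end p) ; unique = Unique-++⁻ʳ xs (unique p) }

  IsPath-++⁻ˡ : ∀ {a b} xs {c ys} → IsPath G a b (xs ++ c ∷ ys) → IsPath G a c (xs ++ c ∷ [])
  IsPath-++⁻ˡ {a} xs {c} {ys} p = record
    { chain  = Chain-++⁻ˡ xs (chain p)
    ; start  = start′ xs (start p)
    ; end    = Last-snoc xs
    ; unique = Unique-++⁻ˡ (xs ++ c ∷ []) (subst Unique (sym (Listₚ.++-assoc xs (c ∷ []) ys)) (unique p))
    }
    where
      start′ : ∀ xs → Σ (List (Fin n)) (λ zs → xs ++ c ∷ ys ≡ a ∷ zs) →
               Σ (List (Fin n)) (λ zs → xs ++ c ∷ [] ≡ a ∷ zs)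
      start′ []       (_ , refl) = [] , refl
      start′ (x ∷ xs) (_ , refl) = xs ++ c ∷ [] , refl

  IsPath-reverse : ∀ {a b xs} → IsPath G a b xs → IsPath G b a (reverse xs)
  IsPath-reverse {a} p with start p
  ... | ys , refl = record { chain = Chain-reverse (chain p) ; start = Last⇒reverse-head (end p)
                           ; end = Last-reverse a ys ; unique = Unique-reverse⁺ (unique p) }

module Tree {n} (T : Graph n) (tree : IsTree T) where
  open import Data.List.Membership.DecPropositional (Fin._≟_ {n}) using (_∈?_)
  open IsPath

  path : Fin n → Fin n → List (Fin n)
  path a b = proj₁ (proj₁ tree a b)

  path-isPath : ∀ a b → IsPath T a b (path a b)
  path-isPath a b = proj₂ (proj₁ tree a b)

  path-unique : ∀ {a b xs} → IsPath T a b xs → xs ≡ path a b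
  path-unique {a} {b} {xs} p = proj₂ tree a b xs (path a b) p (path-isPath a b)

  -- the number of vertices of the path, i.e. d(a,b) + 1
  dist : Fin n → Fin n → ℕ
  dist a b = length (path a b)

  dist-sym : ∀ a b → dist a b ≡ dist b a
  dist-sym a b = trans (sym (Listₚ.length-reverse (path a b)))
                       (cong length (path-unique (IsPath-reverse T (path-isPath a b))))

  start∈path : ∀ a b → a ∈ path a b
  start∈path a b with start (path-isPath a b)
  ... | _ , e = subst (a ∈_) (sym e) (here refl)

  end∈path : ∀ a b → b ∈ path a b
  end∈path a b = Last⇒∈ (end (path-isPath a b))

  dist>0 : ∀ a b → 0 ℕ.< dist a b
  dist>0 a b = ∈-length (start∈path a b)

  IsPath-along : ∀ {a b c} → c ∈ path a b →
    ∃ λ xs → ∃ λ ys → path a b ≡ xs ++ c ∷ ys × IsPath T a b (xs ++ c ∷ ys)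
  IsPath-along {a} {b} c∈ with ∈-∃++ c∈
  ... | xs , ys , e = xs , ys , e , subst (IsPath T a b) e (path-isPath a b)

  path-prefix⊆ : ∀ {a b c x} → c ∈ path a b → x ∈ path a c → x ∈ path a b
  path-prefix⊆ {x = x} c∈ x∈ with IsPath-along c∈
  ... | xs , ys , e , p with ∈-++⁻ xs (subst (x ∈_) (sym (path-unique (IsPath-++⁻ˡ T xs p))) x∈)
  ...   | inj₁ x∈xs       = subst (x ∈_) (sym e) (∈-++⁺ˡ x∈xs)
  ...   | inj₂ (here refl) = subst (x ∈_) (sym e) (∈-++⁺ʳ xs (here refl))

  path-suffix⊆ : ∀ {a b c x} → c ∈ path a b → x ∈ path c b → x ∈ path a b
  path-suffix⊆ {x = x} c∈ x∈ with IsPath-along c∈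
  ... | xs , ys , e , p =
    subst (x ∈_) (sym e) (∈-++⁺ʳ xs (subst (x ∈_) (sym (path-unique (IsPath-++⁻ʳ T xs p))) x∈))

  start∉path-suffix : ∀ {a b c} → c ∈ path a b → a ≢ c → a ∉ path c b
  start∉path-suffix {a} c∈ a≢c a∈ with IsPath-along c∈
  ... | xs , ys , e , p with start p
  ...   | _ , e′ with xs
  ...     | []      = a≢c (sym (Listₚ.∷-injectiveˡ e′))
  ...     | x ∷ xs′ with Listₚ.∷-injective e′
  ...       | refl , _ = Uniqueₚ.Unique[x∷xs]⇒x∉xs (unique p)
              (∈-++⁺ʳ xs′ (subst (a ∈_) (sym (path-unique (IsPath-++⁻ʳ T (a ∷ xs′) p))) a∈))

  dist-infix : ∀ {a b} xs {c} mid {d} ys → IsPath T a b (xs ++ c ∷ mid ++ d ∷ ys) →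
               dist c d ℕ.< length (xs ++ c ∷ mid ++ d ∷ ys) ⊎ (c ≡ a × d ≡ b)
  dist-infix xs {c} mid ys p with length-infix xs {c} mid ys
  ... | inj₁ (refl , refl) =
    inj₂ (Listₚ.∷-injectiveˡ (proj₂ (start p)) , Last-functional (Last-snoc (c ∷ mid)) (end p))
  ... | inj₂ shorter =
    inj₁ (subst (ℕ._< _) (cong length (path-unique (IsPath-++⁻ˡ T (c ∷ mid) (IsPath-++⁻ʳ T xs p)))) shorter)

  dist-ordered : ∀ {a b} xs {c} ys {d} → path a b ≡ xs ++ c ∷ ys → d ∈ ys →
                 dist c d ℕ.< dist a b ⊎ (c ≡ a × d ≡ b)
  dist-ordered {a} {b} xs ys e d∈ with ∈-∃++ d∈
  ... | mid , zs , refl rewrite e = dist-infix xs mid zs (subst (IsPath T a b) e (path-isPath a b))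

  dist-< : ∀ {a b c d} → c ∈ path a b → d ∈ path a b → c ≢ d →
           dist c d ℕ.< dist a b ⊎ Unordered c d a b
  dist-< {a} {b} {c} {d} c∈ d∈ c≢d with ∈-∃++ c∈
  ... | xs , ys , e with ∈-++⁻ xs (subst (d ∈_) e d∈)
  ...   | inj₂ (here d≡c) = ⊥-elim (c≢d (sym d≡c))
  ...   | inj₂ (there d∈ys) = ⊎.map₂ inj₁ (dist-ordered xs ys e d∈ys)
  ...   | inj₁ d∈xs with ∈-∃++ d∈xs
  ...     | xs′ , mid , refl with dist-ordered xs′ (mid ++ c ∷ ys) (trans e (Listₚ.++-assoc xs′ (d ∷ mid) (c ∷ ys)))
                                   (∈-++⁺ʳ mid (here refl))
  ...       | inj₁ dc<ab          = inj₁ (subst (ℕ._< dist a b) (dist-sym d c) dc<ab)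
  ...       | inj₂ (d≡a , c≡b)    = inj₂ (inj₂ (c≡b , d≡a))

  dist-adj : ∀ {x y} c → adj T x y ≡ true → dist x c ℕ.≤ suc (dist y c)
  dist-adj {x} {y} c xy with x ∈? path y c
  ... | no x∉  = ℕₚ.≤-reflexive (cong length (sym (path-unique (IsPath-∷ T xy x∉ (path-isPath y c)))))
  ... | yes x∈ with IsPath-along x∈
  ...   | xs , ys , e , p = ℕₚ.m≤n⇒m≤1+n (subst₂ ℕ._≤_
          (cong length (path-unique (IsPath-++⁻ʳ T xs p))) (cong length (sym e)) (Listₚ.length-++-≤ʳ (x ∷ ys) {xs}))

  WalkIn⇒IsPath : ∀ {P : Fin n → Set} {a b} → WalkIn T P a b → ∃ λ xs → IsPath T a b xs × All P xs
  WalkIn⇒IsPath (here a Pa) = a ∷ [] , IsPath-single T a , Pa ∷ []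
  WalkIn⇒IsPath (step a c b Pa ac w) with WalkIn⇒IsPath w
  ... | xs , p , Pxs with a ∈? xs
  ...   | no a∉  = a ∷ xs , IsPath-∷ T ac a∉ p , Pa ∷ Pxs
  ...   | yes a∈ with ∈-∃++ a∈
  ...     | ys , zs , refl = a ∷ zs , IsPath-++⁻ʳ T ys p , Allₚ.++⁻ʳ ys Pxs

  WalkIn-convex : ∀ {P : Fin n → Set} {a b} → WalkIn T P a b → ∀ {x} → x ∈ path a b → P x
  WalkIn-convex w x∈ with WalkIn⇒IsPath w
  ... | xs , p , Pxs = All.lookup Pxs (subst (_ ∈_) (sym (path-unique p)) x∈)

-- Decompositions with two blocks

module _ {n} (G : Graph n) where

  WalkIn-map : ∀ {P Q : Fin n → Set} → (∀ {c} → P c → Q c) → ∀ {a b} → WalkIn G P a b → WalkIn G Q a b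
  WalkIn-map f (here a Pa)          = here a (f Pa)
  WalkIn-map f (step a c b Pa ac w) = step a c b (f Pa) ac (WalkIn-map f w)

  WalkIn-++ : ∀ {P : Fin n → Set} {a b c} → WalkIn G P a b → WalkIn G P b c → WalkIn G P a c
  WalkIn-++ (here a Pa)          w′ = w′
  WalkIn-++ (step a c b Pa ac w) w′ = step a c _ Pa ac (WalkIn-++ w w′)

  WalkIn-edge : ∀ {P : Fin n → Set} {a b} → P a → P b → adj G a b ≡ true → WalkIn G P a b
  WalkIn-edge {a = a} {b} Pa Pb ab = step a b b Pa ab (here b Pb)

  Connected : List (Fin n) → Set
  Connected B = ∀ {a b} → a ∈ B → b ∈ B → WalkIn G (_∈ B) a b

  Connected-[] : Connected []
  Connected-[] ()

  private
    Chain⇒walk-from-head : ∀ {x xs b} → Chain G (x ∷ xs) → b ∈ x ∷ xs → WalkIn G (_∈ x ∷ xs) x b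
    Chain⇒walk-from-head (single x)         (here refl) = here x (here refl)
    Chain⇒walk-from-head (cons x y _ xy ch) (here refl) = here x (here refl)
    Chain⇒walk-from-head (cons x y _ xy ch) (there b∈)  =
      step x y _ (here refl) xy (WalkIn-map there (Chain⇒walk-from-head ch b∈))

    Chain⇒walk-to-head : ∀ {x xs b} → Chain G (x ∷ xs) → b ∈ x ∷ xs → WalkIn G (_∈ x ∷ xs) b x
    Chain⇒walk-to-head (single x)         (here refl) = here x (here refl)
    Chain⇒walk-to-head (cons x y _ xy ch) (here refl) = here x (here refl)
    Chain⇒walk-to-head (cons x y _ xy ch) (there b∈)  =
      WalkIn-++ (WalkIn-map there (Chain⇒walk-to-head ch b∈))
                (WalkIn-edge (there (here refl)) (here refl) (trans (adj-sym G y x) xy))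

  Chain⇒Connected : ∀ {xs} → Chain G xs → Connected xs
  Chain⇒Connected {[]}    ()
  Chain⇒Connected {_ ∷ _} ch a∈ b∈ = WalkIn-++ (Chain⇒walk-to-head ch a∈) (Chain⇒walk-from-head ch b∈)

  Connected-∷-∈ : ∀ {B x} → Connected B → x ∈ B → Connected (x ∷ B)
  Connected-∷-∈ conn x∈ (here refl) (here refl) = here _ (here refl)
  Connected-∷-∈ conn x∈ (here refl) (there b∈)  = WalkIn-map there (conn x∈ b∈)
  Connected-∷-∈ conn x∈ (there a∈)  (here refl) = WalkIn-map there (conn a∈ x∈)
  Connected-∷-∈ conn x∈ (there a∈)  (there b∈)  = WalkIn-map there (conn a∈ b∈)

  Connected-∷-adj : ∀ {B x m} → Connected B → m ∈ B → adj G x m ≡ true → Connected (x ∷ B)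
  Connected-∷-adj conn m∈ xm (here refl) (here refl) = here _ (here refl)
  Connected-∷-adj conn m∈ xm (here refl) (there b∈)  =
    WalkIn-++ (WalkIn-edge (here refl) (there m∈) xm) (WalkIn-map there (conn m∈ b∈))
  Connected-∷-adj {x = x} {m} conn m∈ xm (there a∈) (here refl) =
    WalkIn-++ (WalkIn-map there (conn a∈ m∈)) (WalkIn-edge (there m∈) (here refl) (trans (adj-sym G m x) xm))
  Connected-∷-adj conn m∈ xm (there a∈)  (there b∈)  = WalkIn-map there (conn a∈ b∈)

  Connected-edge : ∀ {x y} → adj G x y ≡ true → Connected (x ∷ y ∷ [])
  Connected-edge xy = Chain⇒Connected (cons _ _ _ xy (single _))

module TwoBlocks {n} {G : Graph n} (B₁ B₂ : List (Fin n)) (disjoint : ∀ {c} → c ∈ B₁ → c ∈ B₂ → ⊥)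
                 (conn₁ : Connected G B₁) (conn₂ : Connected G B₂) where
  open import Data.List.Membership.DecPropositional (Fin._≟_ {n}) using (_∈?_)

  private
    rep : List (Fin n) → Fin n → Fin n
    rep []      c = c
    rep (x ∷ _) _ = x

    rep-∈ : ∀ {B c} → c ∈ B → rep B c ∈ B
    rep-∈ {_ ∷ _} _ = here refl

    rep-const : ∀ {B c d} → c ∈ B → d ∈ B → rep B c ≡ rep B d
    rep-const {_ ∷ _} _ _ = refl

  label₂ : Fin n → Fin n
  label₂ c with c ∈? B₁ | c ∈? B₂
  ... | yes _ | _     = rep B₁ c
  ... | no _  | yes _ = rep B₂ c
  ... | no _  | no _  = c

  private
    label₂-B₁ : ∀ {c} → c ∈ B₁ → label₂ c ≡ rep B₁ c
    label₂-B₁ {c} c∈ with c ∈? B₁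
    ... | yes _ = refl
    ... | no c∉ = ⊥-elim (c∉ c∈)

    label₂-B₂ : ∀ {c} → c ∈ B₂ → label₂ c ≡ rep B₂ c
    label₂-B₂ {c} c∈ with c ∈? B₁ | c ∈? B₂
    ... | yes c∈₁ | _     = ⊥-elim (disjoint c∈₁ c∈)
    ... | no _    | yes _ = refl
    ... | no _    | no c∉ = ⊥-elim (c∉ c∈)

    label₂-alone : ∀ {c} → c ∉ B₁ → c ∉ B₂ → label₂ c ≡ c
    label₂-alone {c} c∉₁ c∉₂ with c ∈? B₁ | c ∈? B₂
    ... | yes c∈ | _      = ⊥-elim (c∉₁ c∈)
    ... | no _   | yes c∈ = ⊥-elim (c∉₂ c∈)
    ... | no _   | no _   = refl

    label₂-∈B₁ : ∀ {c} → c ∈ B₁ → label₂ c ∈ B₁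
    label₂-∈B₁ c∈ = subst (_∈ B₁) (sym (label₂-B₁ c∈)) (rep-∈ c∈)

    label₂-∈B₂ : ∀ {c} → c ∈ B₂ → label₂ c ∈ B₂
    label₂-∈B₂ c∈ = subst (_∈ B₂) (sym (label₂-B₂ c∈)) (rep-∈ c∈)

    label₂-∈B₁⁻ : ∀ {c} → label₂ c ∈ B₁ → c ∈ B₁
    label₂-∈B₁⁻ {c} l∈ with c ∈? B₁ | c ∈? B₂
    ... | yes c∈ | _      = c∈
    ... | no _   | yes c∈ = ⊥-elim (disjoint l∈ (rep-∈ c∈))
    ... | no _   | no _   = l∈

    label₂-∈B₂⁻ : ∀ {c} → label₂ c ∈ B₂ → c ∈ B₂
    label₂-∈B₂⁻ {c} l∈ with c ∈? B₁ | c ∈? B₂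
    ... | yes c∈ | _      = ⊥-elim (disjoint (rep-∈ c∈) l∈)
    ... | no _   | yes c∈ = c∈
    ... | no _   | no _   = l∈

  SameBlock : Fin n → Fin n → Set
  SameBlock a b = (a ∈ B₁ × b ∈ B₁) ⊎ (a ∈ B₂ × b ∈ B₂) ⊎ a ≡ b

  same-block⇒same-label : ∀ {a b} → SameBlock a b → label₂ a ≡ label₂ b
  same-block⇒same-label (inj₁ (a∈ , b∈)) = trans (label₂-B₁ a∈) (trans (rep-const a∈ b∈) (sym (label₂-B₁ b∈)))
  same-block⇒same-label (inj₂ (inj₁ (a∈ , b∈))) = trans (label₂-B₂ a∈) (trans (rep-const a∈ b∈) (sym (label₂-B₂ b∈)))
  same-block⇒same-label (inj₂ (inj₂ refl)) = refl

  same-label⇒same-block : ∀ a b → label₂ a ≡ label₂ b → SameBlock a b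
  same-label⇒same-block a b e with a ∈? B₁ | a ∈? B₂
  ... | yes a∈ | _      = inj₁ (a∈ , label₂-∈B₁⁻ (subst (_∈ B₁) e (rep-∈ a∈)))
  ... | no _   | yes a∈ = inj₂ (inj₁ (a∈ , label₂-∈B₂⁻ (subst (_∈ B₂) e (rep-∈ a∈))))
  ... | no a∉₁ | no a∉₂ = inj₂ (inj₂ (trans e (label₂-alone b∉₁ b∉₂)))
    where
      b∉₁ : b ∉ B₁
      b∉₁ b∈ = a∉₁ (subst (_∈ B₁) (sym e) (label₂-∈B₁ b∈))
      b∉₂ : b ∉ B₂
      b∉₂ b∈ = a∉₂ (subst (_∈ B₂) (sym e) (label₂-∈B₂ b∈))

  decomposition : Decomposition G
  decomposition = record { label = label₂ ; connected = blocks-connected }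
    where
      blocks-connected : ∀ a b → label₂ a ≡ label₂ b → WalkIn G (λ c → label₂ c ≡ label₂ a) a b
      blocks-connected a b e with same-label⇒same-block a b e
      ... | inj₁ (a∈ , b∈) =
        WalkIn-map G (λ c∈ → same-block⇒same-label (inj₁ (c∈ , a∈))) (conn₁ a∈ b∈)
      ... | inj₂ (inj₁ (a∈ , b∈)) =
        WalkIn-map G (λ c∈ → same-block⇒same-label (inj₂ (inj₁ (c∈ , a∈)))) (conn₂ a∈ b∈)
      ... | inj₂ (inj₂ refl) = here a refl

  alone-separated : ∀ {a b} → a ∉ B₁ → a ∉ B₂ → a ≢ b → label₂ a ≢ label₂ b
  alone-separated {a} {b} a∉₁ a∉₂ a≢b e with same-label⇒same-block a b e
  ... | inj₁ (a∈ , _)        = a∉₁ a∈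
  ... | inj₂ (inj₁ (a∈ , _)) = a∉₂ a∈
  ... | inj₂ (inj₂ a≡b)      = a≢b a≡b

  B₁-separated : ∀ {a b} → a ∈ B₁ → b ∉ B₁ → label₂ a ≢ label₂ b
  B₁-separated {a} {b} a∈ b∉ e with same-label⇒same-block a b e
  ... | inj₁ (_ , b∈)         = b∉ b∈
  ... | inj₂ (inj₁ (a∈₂ , _)) = disjoint a∈ a∈₂
  ... | inj₂ (inj₂ refl)      = b∉ a∈

-- Lifted multicuts and the triangle inequality

module _ {n} {G : Graph n} (D : Decomposition G) where

  χ≡0 : ∀ {a b} → label D a ≡ label D b → χ D a b ≡ 0ℚ
  χ≡0 {a} {b} e with label D a Fin.≟ label D b
  ... | yes _ = refl
  ... | no ne = ⊥-elim (ne e)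

  χ≡1 : ∀ {a b} → label D a ≢ label D b → χ D a b ≡ 1ℚ
  χ≡1 {a} {b} ne with label D a Fin.≟ label D b
  ... | yes e = ⊥-elim (ne e)
  ... | no _  = refl

  χ-sym : ∀ a b → χ D a b ≡ χ D b a
  χ-sym a b with label D a Fin.≟ label D b
  ... | yes e = sym (χ≡0 (sym e))
  ... | no ne = sym (χ≡1 (ne ∘ sym))

  χ-diag : ∀ a → χ D a a ≡ 0ℚ
  χ-diag a = χ≡0 refl

  χ-resp-label : ∀ {a b} c → label D a ≡ label D b → χ D a c ≡ χ D b c
  χ-resp-label {a} {b} c e with label D b Fin.≟ label D c
  ... | yes e′ = χ≡0 (trans e e′)
  ... | no ne  = χ≡1 (λ e′ → ne (trans (sym e) e′))

  1-χ≢0⇒joined : ∀ a b → 1ℚ - χ D a b ≢ 0ℚ → label D a ≡ label D b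
  1-χ≢0⇒joined a b test≢0 with label D a Fin.≟ label D b
  ... | yes a~b = a~b
  ... | no _    = ⊥-elim (test≢0 refl)

  0≤χ : ∀ a b → 0ℚ ≤ χ D a b
  0≤χ a b with label D a Fin.≟ label D b
  ... | yes _ = ℚₚ.≤-refl
  ... | no _  = ℚ.*≤* (ℤ.+≤+ ℕ.z≤n)

  χ≤1 : ∀ a b → χ D a b ≤ 1ℚ
  χ≤1 a b with label D a Fin.≟ label D b
  ... | yes _ = ℚ.*≤* (ℤ.+≤+ ℕ.z≤n)
  ... | no _  = ℚₚ.≤-refl

-- the inequality x_ac ≤ x_ab + x_bc reads excess x a b c ≤ 0
excess : ∀ {n} → QVec n → Fin n → Fin n → Fin n → ℚ
excess x a b c = x a c - (x a b + x b c)

excess-χ-joined : ∀ {n} {G : Graph n} (D : Decomposition G) {a b} c → label D a ≡ label D b → excess (χ D) a b c ≡ 0ℚ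
excess-χ-joined D {a} {b} c a~b rewrite χ≡0 D a~b | χ-resp-label D c a~b | ℚₚ.+-identityˡ (χ D b c) =
  ℚₚ.+-inverseʳ (χ D b c)

excess-χ-apart : ∀ {n} {G : Graph n} (D : Decomposition G) {a b c} →
  label D a ≢ label D b → label D b ≢ label D c → label D a ≢ label D c → excess (χ D) a b c ≡ - 1ℚ
excess-χ-apart D a≁b b≁c a≁c rewrite χ≡1 D a≁b | χ≡1 D b≁c | χ≡1 D a≁c = refl

χ-excess≤0 : ∀ {n} {G : Graph n} (D : Decomposition G) a b c → excess (χ D) a b c ≤ 0ℚ
χ-excess≤0 D a b c = by-cases (label D a Fin.≟ label D b)
  where
    by-cases : Dec (label D a ≡ label D b) → excess (χ D) a b c ≤ 0ℚ
    by-cases (yes a~b) = ℚₚ.≤-reflexive (excess-χ-joined D c a~b)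
    by-cases (no a≁b) = begin
      χ D a c - (χ D a b + χ D b c)   ≡⟨ cong (λ t → χ D a c - (t + χ D b c)) (χ≡1 D a≁b) ⟩
      χ D a c - (1ℚ + χ D b c)        ≤⟨ ℚₚ.+-monoˡ-≤ (- (1ℚ + χ D b c)) (χ≤1 D a c) ⟩
      1ℚ - (1ℚ + χ D b c)             ≡⟨ solve 1 (λ y → con 1ℚ :- (con 1ℚ :+ y) := :- y) refl (χ D b c) ⟩
      - χ D b c                       ≤⟨ ℚₚ.neg-antimono-≤ (0≤χ D b c) ⟩
      0ℚ                              ∎
      where open ℚₚ.≤-Reasoning

excess-linear : ∀ {n} k (μ : Fin k → ℚ) (y : Fin k → QVec n) (x : QVec n) →
  (∀ a b → x a b ≡ Σ[ k ] (λ i → μ i * y i a b)) →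
  ∀ a b c → excess x a b c ≡ Σ[ k ] (λ i → μ i * excess (y i) a b c)
excess-linear k μ y x x≡ a b c = begin
  x a c - (x a b + x b c)                 ≡⟨ cong₂ _-_ (x≡ a c) (cong₂ _+_ (x≡ a b) (x≡ b c)) ⟩
  Σ[ k ] (λ i → μ i * y i a c) - (Σ[ k ] (λ i → μ i * y i a b) + Σ[ k ] (λ i → μ i * y i b c))
    ≡⟨ cong (λ t → Σ[ k ] (λ i → μ i * y i a c) - t) (sym (Σ-+ k _ _)) ⟩
  Σ[ k ] (λ i → μ i * y i a c) - Σ[ k ] (λ i → μ i * y i a b + μ i * y i b c)
    ≡⟨ sym (Σ-- k _ _) ⟩
  Σ[ k ] (λ i → μ i * y i a c - (μ i * y i a b + μ i * y i b c))
    ≡⟨ Σ-cong k (λ i → solve 4 (λ m p q r → m :* p :- (m :* q :+ m :* r) := m :* (p :- (q :+ r))) refl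
                               (μ i) (y i a c) (y i a b) (y i b c)) ⟩
  Σ[ k ] (λ i → μ i * excess (y i) a b c) ∎
  where open ≡-Reasoning

module _ {n} {G : Graph n} where

  χ∈LMC : (D : Decomposition G) → InLMC G (χ D)
  χ∈LMC D = 1 , (λ _ → 1ℚ) , (λ _ → D) , (λ _ → ℚ.*≤* (ℤ.+≤+ ℕ.z≤n)) , refl ,
            λ a b → sym (trans (ℚₚ.+-identityʳ _) (ℚₚ.*-identityˡ _))

  LMC-sym : ∀ {x} → InLMC G x → ∀ a b → x a b ≡ x b a
  LMC-sym (k , w , D , _ , _ , x≡) a b =
    trans (x≡ a b) (trans (Σ-cong k (λ i → cong (w i *_) (χ-sym (D i) a b))) (sym (x≡ b a)))

  LMC-diag : ∀ {x} → InLMC G x → ∀ a → x a a ≡ 0ℚ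
  LMC-diag (k , w , D , _ , _ , x≡) a =
    trans (x≡ a a) (trans (Σ-cong k (λ i → trans (cong (w i *_) (χ-diag (D i) a)) (ℚₚ.*-zeroʳ (w i)))) (Σ-zero k))

  LMC-excess≤0 : ∀ {x} → InLMC G x → ∀ a b c → excess x a b c ≤ 0ℚ
  LMC-excess≤0 {x} (k , w , D , w≥0 , _ , x≡) a b c =
    subst (_≤ 0ℚ) (sym (excess-linear k w (λ i → χ (D i)) x x≡ a b c))
      (Σ-nonpos k _ (λ i → nonNeg*nonPos≤0 (w≥0 i) (χ-excess≤0 (D i) a b c)))

-- Upper bounds on affine rank

Unique⇒lookup-injective : ∀ {A : Set} {xs : List A} → Unique xs → ∀ i j → lookup xs i ≡ lookup xs j → i ≡ j
Unique⇒lookup-injective {xs = x ∷ xs} u        zero    zero    e = refl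
Unique⇒lookup-injective {xs = x ∷ xs} (x∉ ∷ u) zero    (suc j) e = ⊥-elim (All.lookup x∉ (∈-lookup j) e)
Unique⇒lookup-injective {xs = x ∷ xs} (x∉ ∷ u) (suc i) zero    e = ⊥-elim (All.lookup x∉ (∈-lookup i) (sym e))
Unique⇒lookup-injective {xs = x ∷ xs} (_ ∷ u)  (suc i) (suc j) e = cong suc (Unique⇒lookup-injective u i j e)

unordered-≡ : ∀ {n} {a b a′ b′ : Fin n} → a Fin.< b → a′ Fin.< b′ → Unordered a b a′ b′ → (a , b) ≡ (a′ , b′)
unordered-≡ _   _     (inj₁ (refl , refl)) = refl
unordered-≡ a<b a′<b′ (inj₂ (refl , refl)) = ⊥-elim (Finₚ.<-asym a<b a′<b′)

module Pairs (n : ℕ) where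

  -- the coordinates of ℚ^(V choose 2): the pairs a < b
  pairs : List (Fin n × Fin n)
  pairs = filter (λ p → proj₁ p Fin.<? proj₂ p) (cartesianProduct (allFin n) (allFin n))

  #pairs : ℕ
  #pairs = length pairs

  ∈-pairs : ∀ {a b} → a Fin.< b → (a , b) ∈ pairs
  ∈-pairs a<b = ∈-filter⁺ _ (∈-cartesianProduct⁺ (∈-allFin _) (∈-allFin _)) a<b

  ∈-pairs⁻ : ∀ {p} → p ∈ pairs → proj₁ p Fin.< proj₂ p
  ∈-pairs⁻ p∈ = proj₂ (∈-filter⁻ _ {xs = cartesianProduct (allFin n) (allFin n)} p∈)

  pair : Fin #pairs → Fin n × Fin n
  pair = lookup pairs

  pair-< : ∀ i → proj₁ (pair i) Fin.< proj₂ (pair i)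
  pair-< i = ∈-pairs⁻ (∈-lookup i)

  pair-injective : ∀ i j → pair i ≡ pair j → i ≡ j
  pair-injective = Unique⇒lookup-injective
    (Uniqueₚ.filter⁺ _ (Uniqueₚ.cartesianProduct⁺ (Uniqueₚ.allFin⁺ n) (Uniqueₚ.allFin⁺ n)))

  sorted : ∀ {a b} → a ≢ b → ∃ λ p → p ∈ pairs × Unordered (proj₁ p) (proj₂ p) a b
  sorted {a} {b} a≢b with Finₚ.<-cmp a b
  ... | tri< a<b _ _ = (a , b) , ∈-pairs a<b , inj₁ (refl , refl)
  ... | tri≈ _ a≡b _ = ⊥-elim (a≢b a≡b)
  ... | tri> _ _ b<a = (b , a) , ∈-pairs b<a , inj₂ (refl , refl)

  zero-on-pairs⇒zero : (S : Fin n → Fin n → ℚ) → (∀ a b → S a b ≡ S b a) → (∀ a → S a a ≡ 0ℚ) →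
                       (∀ {p} → p ∈ pairs → S (proj₁ p) (proj₂ p) ≡ 0ℚ) → ∀ a b → S a b ≡ 0ℚ
  zero-on-pairs⇒zero S S-sym S-diag S-pairs a b with Finₚ.<-cmp a b
  ... | tri< a<b _ _ = S-pairs (∈-pairs a<b)
  ... | tri≈ _ refl _ = S-diag a
  ... | tri> _ _ b<a = trans (S-sym a b) (S-pairs (∈-pairs b<a))

-- coordinate nothing is the constant 1, which turns affine into linear dependence
affine-coordinate : ∀ {n k} → (Fin k → QVec n) → Fin k → Maybe (Fin n × Fin n) → ℚ
affine-coordinate z i nothing  = 1ℚ
affine-coordinate z i (just p) = z i (proj₁ p) (proj₂ p)

few-coordinates⇒¬AffIndep : ∀ {n k} (z : Fin k → QVec n) (cs : List (Fin n × Fin n)) → suc (length cs) ℕ.< k →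
  (∀ (μ : Fin k → ℚ) → All (λ p → Σ[ k ] (λ i → μ i * z i (proj₁ p) (proj₂ p)) ≡ 0ℚ) cs →
         ∀ a b → Σ[ k ] (λ i → μ i * z i a b) ≡ 0ℚ) →
  ¬ AffIndep z
few-coordinates⇒¬AffIndep {k = k} z cs |cs|<k determined independent
  with fewer-coordinates⇒dependent (nothing ∷ map just cs) (affine-coordinate z)
         (subst (λ m → suc m ℕ.< k) (sym (Listₚ.length-map just cs)) |cs|<k)
... | μ , (i , μi≢0) , Σμ≡0 ∷ on-cs = μi≢0 (independent μ Σμ≡0′ (determined μ (Allₚ.map⁻ on-cs)) i)
  where
    Σμ≡0′ : Σ[ k ] μ ≡ 0ℚ
    Σμ≡0′ = trans (Σ-cong k (λ i → sym (ℚₚ.*-identityʳ (μ i)))) Σμ≡0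

module _ {n} {G : Graph n} where
  open Pairs n

  private
    combination-sym : ∀ {k} (z : Fin k → QVec n) → (∀ i → InLMC G (z i)) → ∀ (μ : Fin k → ℚ) a b →
      Σ[ k ] (λ i → μ i * z i a b) ≡ Σ[ k ] (λ i → μ i * z i b a)
    combination-sym {k} z z∈ μ a b = Σ-cong k (λ i → cong (μ i *_) (LMC-sym (z∈ i) a b))

    combination-diag : ∀ {k} (z : Fin k → QVec n) → (∀ i → InLMC G (z i)) → ∀ (μ : Fin k → ℚ) a →
      Σ[ k ] (λ i → μ i * z i a a) ≡ 0ℚ
    combination-diag {k} z z∈ μ a =
      trans (Σ-cong k (λ i → trans (cong (μ i *_) (LMC-diag (z∈ i) a)) (ℚₚ.*-zeroʳ (μ i)))) (Σ-zero k)

  LMC-¬AffIndep : (z : Fin (suc (suc #pairs)) → QVec n) → (∀ i → InLMC G (z i)) → ¬ AffIndep z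
  LMC-¬AffIndep z z∈ = few-coordinates⇒¬AffIndep z pairs ℕₚ.≤-refl λ μ on-pairs →
    zero-on-pairs⇒zero (λ a b → Σ[ _ ] (λ i → μ i * z i a b)) (combination-sym z z∈ μ) (combination-diag z z∈ μ)
      (All.lookup on-pairs)

  -- on the face x_uv = x_uw + x_wv, so the coordinate uv can be dropped
  face-combination-determined : ∀ {k u w v p} → u ≢ v → u ≢ w → w ≢ v → Unordered (proj₁ p) (proj₂ p) u v →
    (z : Fin k → QVec n) → (∀ i → InLMC G (z i) × excess (z i) u w v ≡ 0ℚ) → (μ : Fin k → ℚ) →
    (∀ {q} → q ∈ pairs → q ≢ p → Σ[ k ] (λ i → μ i * z i (proj₁ q) (proj₂ q)) ≡ 0ℚ) →
    ∀ a b → Σ[ k ] (λ i → μ i * z i a b) ≡ 0ℚ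
  face-combination-determined {k} {u} {w} {v} {p} u≢v u≢w w≢v p-uv z z∈ μ S-other =
    zero-on-pairs⇒zero S S-sym (combination-diag z (proj₁ ∘ z∈) μ) S-pairs
    where
      S : Fin n → Fin n → ℚ
      S a b = Σ[ k ] (λ i → μ i * z i a b)
      S-sym : ∀ a b → S a b ≡ S b a
      S-sym = combination-sym z (proj₁ ∘ z∈) μ
      S-off : ∀ a b → a ≢ b → ¬ Unordered a b u v → S a b ≡ 0ℚ
      S-off a b a≢b ¬uv with sorted a≢b
      ... | _ , q∈ , inj₁ (refl , refl) = S-other q∈ λ { refl → ¬uv p-uv }
      ... | _ , q∈ , inj₂ (refl , refl) = trans (S-sym a b) (S-other q∈ λ { refl → ¬uv (unordered-swap p-uv) })
      S-uv : S u v ≡ 0ℚ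
      S-uv = begin
        S u v                          ≡⟨ sym (ℚₚ.+-identityʳ (S u v)) ⟩
        S u v - (0ℚ + 0ℚ)              ≡⟨ cong (λ t → S u v - t) (sym (cong₂ _+_ S-uw S-wv)) ⟩
        excess S u w v                 ≡⟨ excess-linear k μ z S (λ _ _ → refl) u w v ⟩
        Σ[ k ] (λ i → μ i * excess (z i) u w v)
          ≡⟨ Σ-cong k (λ i → trans (cong (μ i *_) (proj₂ (z∈ i))) (ℚₚ.*-zeroʳ (μ i))) ⟩
        Σ[ k ] (λ _ → 0ℚ)              ≡⟨ Σ-zero k ⟩
        0ℚ                             ∎
        where
          open ≡-Reasoning
          S-uw : S u w ≡ 0ℚ
          S-uw = S-off u w u≢w λ { (inj₁ (_ , w≡v)) → w≢v w≡v ; (inj₂ (u≡v , _)) → u≢v u≡v }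
          S-wv : S w v ≡ 0ℚ
          S-wv = S-off w v w≢v λ { (inj₁ (w≡u , _)) → u≢w (sym w≡u) ; (inj₂ (_ , v≡u)) → u≢v (sym v≡u) }
      S-pairs : ∀ {q} → q ∈ pairs → S (proj₁ q) (proj₂ q) ≡ 0ℚ
      S-pairs {q} q∈ with ≡-dec Fin._≟_ Fin._≟_ q p
      ... | no q≢p = S-other q∈ q≢p
      ... | yes refl = [ (λ (p₁≡u , p₂≡v) → subst₂ S≡0 (sym p₁≡u) (sym p₂≡v) S-uv)
                       , (λ (p₁≡v , p₂≡u) → subst₂ S≡0 (sym p₁≡v) (sym p₂≡u) (trans (S-sym v u) S-uv)) ]′ p-uv
        where
          S≡0 : Fin n → Fin n → Set
          S≡0 a b = S a b ≡ 0ℚ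

  face-¬AffIndep : ∀ {u w v} → u ≢ v → u ≢ w → w ≢ v → (z : Fin (suc #pairs) → QVec n) →
    (∀ i → InLMC G (z i) × excess (z i) u w v ≡ 0ℚ) → ¬ AffIndep z
  face-¬AffIndep u≢v u≢w w≢v z z∈ with sorted u≢v
  ... | p , p∈ , p-uv with ∈-∃++ p∈
  ...   | xs , ys , pairs≡ = few-coordinates⇒¬AffIndep z (xs ++ ys) (s≤s (ℕₚ.≤-reflexive |cs|≡)) λ μ on-cs →
    face-combination-determined u≢v u≢w w≢v p-uv z z∈ μ λ q∈ q≢p →
      [ All.lookup on-cs ∘ ∈-++⁺ˡ , [ (λ q≡p → ⊥-elim (q≢p q≡p)) , All.lookup on-cs ∘ ∈-++⁺ʳ xs ]′ ∘ toSum ]′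
        (∈-++⁻ xs (subst (_ ∈_) pairs≡ q∈))
    where
      |cs|≡ : suc (length (xs ++ ys)) ≡ #pairs
      |cs|≡ = trans (sym (Listₚ.length-++-sucʳ xs p ys)) (cong length (sym pairs≡))

-- Distance at least three: not a facet

+-cancel-zeroˡ : ∀ {p q} → p ≡ 0ℚ → p + q ≡ 0ℚ → q ≡ 0ℚ
+-cancel-zeroˡ {p} {q} p≡0 p+q≡0 = trans (sym (ℚₚ.+-identityˡ q)) (trans (cong (_+ q) (sym p≡0)) p+q≡0)

AffIndep-∷ : ∀ {n r} {p : QVec n} {y : Fin r → QVec n} a b c → excess p a b c ≢ 0ℚ →
             (∀ i → excess (y i) a b c ≡ 0ℚ) → AffIndep y → AffIndep (p ∷ᶠ y)
AffIndep-∷ {r = r} {p} {y} a b c p-off y-on y-indep μ Σμ≡0 combination≡0 = λ where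
    zero    → μ₀≡0
    (suc i) → y-indep (λ i → μ (suc i)) (+-cancel-zeroˡ μ₀≡0 Σμ≡0)
                (λ a′ b′ → +-cancel-zeroˡ (head≡0 a′ b′) (combination≡0 a′ b′)) i
  where
    tail-excess≡0 : Σ[ r ] (λ i → μ (suc i) * excess (y i) a b c) ≡ 0ℚ
    tail-excess≡0 = trans (Σ-cong r (λ i → trans (cong (μ (suc i) *_) (y-on i)) (ℚₚ.*-zeroʳ (μ (suc i))))) (Σ-zero r)
    μ₀≡0 : μ zero ≡ 0ℚ
    μ₀≡0 = p*q≡0⇒p≡0 (μ zero) (excess p a b c) p-off (begin
      μ zero * excess p a b c                               ≡⟨ sym (ℚₚ.+-identityʳ _) ⟩
      μ zero * excess p a b c + 0ℚ                          ≡⟨ cong (μ zero * excess p a b c +_) (sym tail-excess≡0) ⟩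
      Σ[ suc r ] (λ i → μ i * excess ((p ∷ᶠ y) i) a b c)
        ≡⟨ sym (excess-linear (suc r) μ (p ∷ᶠ y) (λ _ _ → 0ℚ) (λ a′ b′ → sym (combination≡0 a′ b′)) a b c) ⟩
      0ℚ                                                    ∎)
      where open ≡-Reasoning
    head≡0 : ∀ a′ b′ → μ zero * p a′ b′ ≡ 0ℚ
    head≡0 a′ b′ = trans (cong (_* p a′ b′) μ₀≡0) (ℚₚ.*-zeroˡ (p a′ b′))

singletons : ∀ {n} {G : Graph n} → Decomposition G
singletons {G = G} = record
  { label     = λ a → a
  ; connected = λ a b a≡b → subst (WalkIn G (λ c → c ≡ a) a) a≡b (here a refl) }

-1≢0 : - 1ℚ ≢ 0ℚ
-1≢0 ()

-2≢0 : 0ℚ - (1ℚ + 1ℚ) ≢ 0ℚ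
-2≢0 ()

module _ {n} {T : Graph n} (tree : IsTree T) where
  open Tree T tree

  χ-excess-along : ∀ (D : Decomposition T) {u w v t} → t ∈ path w v →
                   excess (χ D) u w v ≡ 0ℚ → excess (χ D) u w t ≡ 0ℚ
  χ-excess-along D {u} {w} {v} {t} t∈ on-face =
    by-cases (label D u Fin.≟ label D w) (label D w Fin.≟ label D v) (label D u Fin.≟ label D v)
    where
      by-cases : Dec (label D u ≡ label D w) → Dec (label D w ≡ label D v) → Dec (label D u ≡ label D v) →
                 excess (χ D) u w t ≡ 0ℚ
      by-cases (yes u~w) _ _ = excess-χ-joined D t u~w
      by-cases (no u≁w) (yes w~v) _ =
        cong₂ _-_ (χ≡1 D (u≁w ∘ (λ u~t → trans u~t t~w))) (cong₂ _+_ (χ≡1 D u≁w) (χ≡0 D (sym t~w)))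
        where
          t~w : label D t ≡ label D w
          t~w = WalkIn-convex (connected D w v w~v) t∈
      by-cases (no u≁w) (no w≁v) (yes u~v) =
        ⊥-elim (-2≢0 (trans (sym (cong₂ _-_ (χ≡0 D u~v) (cong₂ _+_ (χ≡1 D u≁w) (χ≡1 D w≁v)))) on-face))
      by-cases (no u≁w) (no w≁v) (no u≁v) = ⊥-elim (-1≢0 (trans (sym (excess-χ-apart D u≁w w≁v u≁v)) on-face))

  LMC-excess-along : ∀ {x u w v t} → InLMC T x → t ∈ path w v → excess x u w v ≡ 0ℚ → excess x u w t ≡ 0ℚ
  LMC-excess-along {x} {u} {w} {v} {t} (k , ω , D , ω≥0 , _ , x≡) t∈ on-face =
    trans (excess-linear k ω (χ ∘ D) x x≡ u w t) (trans (Σ-cong k term≡0) (Σ-zero k))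
    where
      terms-uwv≡0 : ∀ i → ω i * excess (χ (D i)) u w v ≡ 0ℚ
      terms-uwv≡0 = Σ-nonpos-zero k _ (λ i → nonNeg*nonPos≤0 (ω≥0 i) (χ-excess≤0 (D i) u w v))
                      (trans (sym (excess-linear k ω (χ ∘ D) x x≡ u w v)) on-face)
      term≡0 : ∀ i → ω i * excess (χ (D i)) u w t ≡ 0ℚ
      term≡0 i with ω i ℚ.≟ 0ℚ
      ... | yes ωi≡0 = trans (cong (_* excess (χ (D i)) u w t) ωi≡0) (ℚₚ.*-zeroˡ (excess (χ (D i)) u w t))
      ... | no ωi≢0  = trans (cong (ω i *_) (χ-excess-along (D i) t∈ D-on-face)) (ℚₚ.*-zeroʳ (ω i))
        where
          D-on-face : excess (χ (D i)) u w v ≡ 0ℚ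
          D-on-face = p*q≡0⇒p≡0 _ (ω i) ωi≢0 (trans (ℚₚ.*-comm _ (ω i)) (terms-uwv≡0 i))

  -- the singleton and {w,w₂} decompositions extend a basis of the face by two points
  distance≥3⇒¬facet : ∀ {u v w w₂ y ys} → IsPath T u v (u ∷ w ∷ w₂ ∷ y ∷ ys) →
                      ¬ DefinesFacet (InLMC T) (λ x → excess x u w v) 0ℚ
  distance≥3⇒¬facet {u} {v} {w} {w₂} {y} {ys} p (_ , r , (_ , LMC-dependent) , (face-points , face∈ , face-indep) , _)
    with IsPath.unique p | IsPath.chain p
  ... | (u≢w ∷ u≢w₂ ∷ u∉ys) ∷ (w≢w₂ ∷ w∉ys) ∷ w₂∉ys ∷ _ | cons _ _ _ _ (cons _ _ _ ww₂ _) =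
    LMC-dependent points points∈LMC
      (AffIndep-∷ {y = χ edge ∷ᶠ face-points} u w w₂ singletons-off edge-and-face-on
        (AffIndep-∷ {y = face-points} u w v edge-off (proj₂ ∘ face∈) face-indep))
    where
      v∈ : v ∈ y ∷ ys
      v∈ = Last⇒∈ (Last-∷⁻ (Last-∷⁻ (Last-∷⁻ (IsPath.end p))))
      u≢v : u ≢ v
      u≢v = All.lookup u∉ys v∈
      w≢v : w ≢ v
      w≢v = All.lookup w∉ys v∈
      w₂≢v : w₂ ≢ v
      w₂≢v = All.lookup w₂∉ys v∈
      w₂∈ : w₂ ∈ path w v
      w₂∈ = subst (w₂ ∈_) (path-unique (IsPath-++⁻ʳ T (u ∷ []) p)) (there (here refl))

      module Edge = TwoBlocks (w ∷ w₂ ∷ []) [] (λ _ ()) (Connected-edge T ww₂) (Connected-[] T)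
      edge : Decomposition T
      edge = Edge.decomposition
      w~w₂ : label edge w ≡ label edge w₂
      w~w₂ = Edge.same-block⇒same-label (inj₁ (here refl , there (here refl)))
      edge-separates : ∀ {a} → a ≢ w → a ≢ w₂ → ∀ {b} → a ≢ b → label edge a ≢ label edge b
      edge-separates a≢w a≢w₂ =
        Edge.alone-separated (λ { (here a≡w) → a≢w a≡w ; (there (here a≡w₂)) → a≢w₂ a≡w₂ }) (λ ())

      points : Fin (suc (suc r)) → QVec n
      points = χ singletons ∷ᶠ χ edge ∷ᶠ face-points
      points∈LMC : ∀ i → InLMC T (points i)
      points∈LMC zero          = χ∈LMC singletons
      points∈LMC (suc zero)    = χ∈LMC edge
      points∈LMC (suc (suc i)) = proj₁ (face∈ i)

      singletons-off : excess (χ singletons) u w w₂ ≢ 0ℚ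
      singletons-off = -1≢0 ∘ trans (sym (excess-χ-apart singletons u≢w w≢w₂ u≢w₂))
      edge-off : excess (χ edge) u w v ≢ 0ℚ
      edge-off = -1≢0 ∘ trans (sym (excess-χ-apart edge {u} {w} {v} (edge-separates u≢w u≢w₂ u≢w)
                                     (edge-separates (w≢v ∘ sym) (w₂≢v ∘ sym) (w≢v ∘ sym) ∘ sym)
                                     (edge-separates u≢w u≢w₂ u≢v)))
      edge-and-face-on : ∀ i → excess ((χ edge ∷ᶠ face-points) i) u w w₂ ≡ 0ℚ
      edge-and-face-on zero    = cong₂ _-_ (χ≡1 edge {u} {w₂} (edge-separates u≢w u≢w₂ u≢w₂))
                                   (cong₂ _+_ (χ≡1 edge {u} {w} (edge-separates u≢w u≢w₂ u≢w))
                                              (χ≡0 edge {w} {w₂} w~w₂))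
      edge-and-face-on (suc i) = LMC-excess-along (proj₁ (face∈ i)) w₂∈ (proj₂ (face∈ i))

-- Distance two: a facet

-- One lifted multicut on the face per pair: the block {u,w} for the pair uw; the path ab, merged
-- with {u,w} when it meets them, for pairs avoiding u; for a pair uc, one with w ~ v and u ≁ w
-- joining c to u or to w. Against the tests 1, 1 - x_ab and x_wc - x_uc they form a triangular
-- system for rank: shorter pairs, and pairs containing w, come first.
module DistanceTwo {n} {T : Graph n} (tree : IsTree T) {u w v : Fin n}
                    (uwv : IsPath T u v (u ∷ w ∷ v ∷ [])) where
  open Tree T tree
  open import Data.List.Membership.DecPropositional (Fin._≟_ {n}) using (_∈?_)

  private
    distinct : (u ≢ w × u ≢ v) × w ≢ v
    distinct with IsPath.unique uwv
    ... | (u≢w ∷ u≢v ∷ []) ∷ (w≢v ∷ []) ∷ _ = (u≢w , u≢v) , w≢v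

  u≢w : u ≢ w
  u≢w = proj₁ (proj₁ distinct)
  u≢v : u ≢ v
  u≢v = proj₂ (proj₁ distinct)
  w≢v : w ≢ v
  w≢v = proj₂ distinct

  adj-uw : adj T u w ≡ true
  adj-uw with IsPath.chain uwv
  ... | cons _ _ _ uw _ = uw

  adj-wv : adj T w v ≡ true
  adj-wv with IsPath.chain uwv
  ... | cons _ _ _ _ (cons _ _ _ wv _) = wv

  adj-wu : adj T w u ≡ true
  adj-wu = trans (adj-sym T w u) adj-uw

  w∈path-uv : w ∈ path u v
  w∈path-uv = subst (w ∈_) (path-unique uwv) (there (here refl))

  path-connected : ∀ a b → Connected T (path a b)
  path-connected a b = Chain⇒Connected T (IsPath.chain (path-isPath a b))

  on-face-split : ∀ (D : Decomposition T) → label D u ≢ label D w → label D u ≢ label D v → label D w ≡ label D v →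
                  excess (χ D) u w v ≡ 0ℚ
  on-face-split D u≁w u≁v w~v = cong₂ _-_ (χ≡1 D u≁v) (cong₂ _+_ (χ≡1 D u≁w) (χ≡0 D w~v))

  module UW = TwoBlocks (u ∷ w ∷ []) [] (λ _ ()) (Connected-edge T adj-uw) (Connected-[] T)

  D-uw : Decomposition T
  D-uw = UW.decomposition

  D-uw-joins : label D-uw u ≡ label D-uw w
  D-uw-joins = UW.same-block⇒same-label (inj₁ (here refl , there (here refl)))

  D-uw-joins-only-uw : ∀ {x y} → label D-uw x ≡ label D-uw y → x ≢ y → x ≢ u → y ≢ u → ⊥
  D-uw-joins-only-uw {x} {y} x~y x≢y x≢u y≢u with UW.same-label⇒same-block x y x~y
  ... | inj₁ (here x≡u , _)                   = x≢u x≡u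
  ... | inj₁ (_ , here y≡u)                   = y≢u y≡u
  ... | inj₁ (there (here x≡w) , there (here y≡w)) = x≢y (trans x≡w (sym y≡w))
  ... | inj₂ (inj₁ (() , _))
  ... | inj₂ (inj₂ x≡y)                       = x≢y x≡y

  Meets : Fin n → Fin n → Set
  Meets a b = u ∈ path a b ⊎ w ∈ path a b

  meets? : ∀ a b → Dec (Meets a b)
  meets? a b = (u ∈? path a b) ⊎-dec (w ∈? path a b)

  module Through (a b : Fin n) where
    merged-connected : Meets a b → Connected T (u ∷ w ∷ path a b)
    merged-connected (inj₁ u∈) = Connected-∷-∈ T (Connected-∷-adj T (path-connected a b) u∈ adj-wu) (there u∈)
    merged-connected (inj₂ w∈) = Connected-∷-adj T (Connected-∷-∈ T (path-connected a b) w∈) (here refl) adj-uw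

    apart : ¬ Meets a b → ∀ {c} → c ∈ path a b → c ∈ u ∷ w ∷ [] → ⊥
    apart ¬meets c∈ (here refl)         = ¬meets (inj₁ c∈)
    apart ¬meets c∈ (there (here refl)) = ¬meets (inj₂ c∈)

    module Merged (m : Meets a b) =
      TwoBlocks (u ∷ w ∷ path a b) [] (λ _ ()) (merged-connected m) (Connected-[] T)
    module Apart (¬m : ¬ Meets a b) =
      TwoBlocks (path a b) (u ∷ w ∷ []) (apart ¬m) (path-connected a b) (Connected-edge T adj-uw)

    D : Dec (Meets a b) → Decomposition T
    D (yes m)  = Merged.decomposition m
    D (no ¬m)  = Apart.decomposition ¬m

    joins-uw : ∀ d → label (D d) u ≡ label (D d) w
    joins-uw (yes m) = Merged.same-block⇒same-label m (inj₁ (here refl , there (here refl)))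
    joins-uw (no ¬m) = Apart.same-block⇒same-label ¬m (inj₂ (inj₁ (here refl , there (here refl))))

    joins-ab : ∀ d → label (D d) a ≡ label (D d) b
    joins-ab (yes m) =
      Merged.same-block⇒same-label m (inj₁ (there (there (start∈path a b)) , there (there (end∈path a b))))
    joins-ab (no ¬m) = Apart.same-block⇒same-label ¬m (inj₁ (start∈path a b , end∈path a b))

    Joined : Fin n → Fin n → Set
    Joined x y = (x ∈ path a b × y ∈ path a b) ⊎ (((x ≡ w × y ∈ path a b) ⊎ (x ∈ path a b × y ≡ w)) × Meets a b)

    joined : ∀ d {x y} → label (D d) x ≡ label (D d) y → x ≢ y → x ≢ u → y ≢ u → Joined x y
    joined (yes m) {x} {y} x~y x≢y x≢u y≢u with Merged.same-label⇒same-block m x y x~y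
    ... | inj₁ (here x≡u , _)                          = ⊥-elim (x≢u x≡u)
    ... | inj₁ (_ , here y≡u)                          = ⊥-elim (y≢u y≡u)
    ... | inj₁ (there (here x≡w) , there (here y≡w))   = ⊥-elim (x≢y (trans x≡w (sym y≡w)))
    ... | inj₁ (there (here x≡w) , there (there y∈))   = inj₂ (inj₁ (x≡w , y∈) , m)
    ... | inj₁ (there (there x∈) , there (here y≡w))   = inj₂ (inj₂ (x∈ , y≡w) , m)
    ... | inj₁ (there (there x∈) , there (there y∈))   = inj₁ (x∈ , y∈)
    ... | inj₂ (inj₁ (() , _))
    ... | inj₂ (inj₂ x≡y)                              = ⊥-elim (x≢y x≡y)
    joined (no ¬m) {x} {y} x~y x≢y x≢u y≢u with Apart.same-label⇒same-block ¬m x y x~y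
    ... | inj₁ x,y∈                                            = inj₁ x,y∈
    ... | inj₂ (inj₁ (here x≡u , _))                           = ⊥-elim (x≢u x≡u)
    ... | inj₂ (inj₁ (_ , here y≡u))                           = ⊥-elim (y≢u y≡u)
    ... | inj₂ (inj₁ (there (here x≡w) , there (here y≡w)))    = ⊥-elim (x≢y (trans x≡w (sym y≡w)))
    ... | inj₂ (inj₂ x≡y)                                      = ⊥-elim (x≢y x≡y)

  module From (c : Fin n) where
    v∉path-uc : w ∉ path u c → v ∉ path u c
    v∉path-uc w∉ v∈ = w∉ (path-prefix⊆ v∈ w∈path-uv)

    apart : w ∉ path u c → ∀ {x} → x ∈ path u c → x ∈ w ∷ v ∷ [] → ⊥
    apart w∉ x∈ (here refl)         = w∉ x∈
    apart w∉ x∈ (there (here refl)) = v∉path-uc w∉ x∈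

    u∉block : w ∈ path u c → u ∉ v ∷ path w c
    u∉block w∈ (here u≡v)  = u≢v u≡v
    u∉block w∈ (there u∈) = start∉path-suffix w∈ u≢w u∈

    module Beyond (w∈ : w ∈ path u c) =
      TwoBlocks (v ∷ path w c) [] (λ _ ())
        (Connected-∷-adj T (path-connected w c) (start∈path w c) (trans (adj-sym T v w) adj-wv)) (Connected-[] T)
    module Before (w∉ : w ∉ path u c) =
      TwoBlocks (path u c) (w ∷ v ∷ []) (apart w∉) (path-connected u c) (Connected-edge T adj-wv)

    D : Dec (w ∈ path u c) → Decomposition T
    D (yes w∈) = Beyond.decomposition w∈
    D (no w∉)  = Before.decomposition w∉

    on-face : ∀ d → excess (χ (D d)) u w v ≡ 0ℚ
    on-face (yes w∈) = on-face-split (D (yes w∈))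
      (Beyond.alone-separated w∈ (u∉block w∈) (λ ()) u≢w) (Beyond.alone-separated w∈ (u∉block w∈) (λ ()) u≢v)
      (Beyond.same-block⇒same-label w∈ (inj₁ (there (start∈path w c) , here refl)))
    on-face (no w∉) = on-face-split (D (no w∉))
      (Before.B₁-separated w∉ (start∈path u c) w∉) (Before.B₁-separated w∉ (start∈path u c) (v∉path-uc w∉))
      (Before.same-block⇒same-label w∉ (inj₂ (inj₁ (here refl , there (here refl)))))

    test≢0 : ∀ d → c ≢ u → c ≢ w → χ (D d) w c - χ (D d) u c ≢ 0ℚ
    test≢0 (yes w∈) c≢u c≢w =
      0-1≢0 ∘ trans (sym (cong₂ _-_ (χ≡0 (D (yes w∈)) {w} {c} w~c) (χ≡1 (D (yes w∈)) {u} {c} u≁c)))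
      where
        0-1≢0 : 0ℚ - 1ℚ ≢ 0ℚ
        0-1≢0 ()
        w~c : label (D (yes w∈)) w ≡ label (D (yes w∈)) c
        w~c = Beyond.same-block⇒same-label w∈ (inj₁ (there (start∈path w c) , there (end∈path w c)))
        u≁c : label (D (yes w∈)) u ≢ label (D (yes w∈)) c
        u≁c = Beyond.alone-separated w∈ (u∉block w∈) (λ ()) (c≢u ∘ sym)
    test≢0 (no w∉) c≢u c≢w =
      1-0≢0 ∘ trans (sym (cong₂ _-_ (χ≡1 (D (no w∉)) {w} {c} w≁c) (χ≡0 (D (no w∉)) {u} {c} u~c)))
      where
        1-0≢0 : 1ℚ - 0ℚ ≢ 0ℚ
        1-0≢0 ()
        u~c : label (D (no w∉)) u ≡ label (D (no w∉)) c
        u~c = Before.same-block⇒same-label w∉ (inj₁ (start∈path u c , end∈path u c))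
        w≁c : label (D (no w∉)) w ≢ label (D (no w∉)) c
        w≁c = Before.B₁-separated w∉ (end∈path u c) w∉ ∘ sym

    joined : ∀ d {x} → x ≢ u → x ≢ w → label (D d) u ≡ label (D d) x ⊎ label (D d) w ≡ label (D d) x →
             x ≡ v ⊎ x ∈ path u c
    joined (yes w∈) {x} x≢u x≢w (inj₁ u~x) with Beyond.same-label⇒same-block w∈ u x u~x
    ... | inj₁ (u∈ , _)        = ⊥-elim (u∉block w∈ u∈)
    ... | inj₂ (inj₁ (() , _))
    ... | inj₂ (inj₂ u≡x)      = ⊥-elim (x≢u (sym u≡x))
    joined (yes w∈) {x} x≢u x≢w (inj₂ w~x) with Beyond.same-label⇒same-block w∈ w x w~x
    ... | inj₁ (_ , here x≡v)  = inj₁ x≡v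
    ... | inj₁ (_ , there x∈)  = inj₂ (path-suffix⊆ w∈ x∈)
    ... | inj₂ (inj₁ (() , _))
    ... | inj₂ (inj₂ w≡x)      = ⊥-elim (x≢w (sym w≡x))
    joined (no w∉) {x} x≢u x≢w (inj₁ u~x) with Before.same-label⇒same-block w∉ u x u~x
    ... | inj₁ (_ , x∈)                        = inj₂ x∈
    ... | inj₂ (inj₁ (here u≡w , _))           = ⊥-elim (u≢w u≡w)
    ... | inj₂ (inj₁ (there (here u≡v) , _))   = ⊥-elim (u≢v u≡v)
    ... | inj₂ (inj₂ u≡x)                      = ⊥-elim (x≢u (sym u≡x))
    joined (no w∉) {x} x≢u x≢w (inj₂ w~x) with Before.same-label⇒same-block w∉ w x w~x
    ... | inj₁ (w∈ , _)                        = ⊥-elim (w∉ w∈)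
    ... | inj₂ (inj₁ (_ , here x≡w))           = ⊥-elim (x≢w x≡w)
    ... | inj₂ (inj₁ (_ , there (here x≡v)))   = inj₁ x≡v
    ... | inj₂ (inj₂ w≡x)                      = ⊥-elim (x≢w (sym w≡x))

  touches-w? : ∀ a b → Dec (a ≡ w ⊎ b ≡ w)
  touches-w? a b = (a Fin.≟ w) ⊎-dec (b Fin.≟ w)

  key : Fin n → Fin n → ℕ
  key a b with touches-w? a b
  ... | yes _ = dist a b ℕ.+ dist a b
  ... | no _  = suc (dist a b ℕ.+ dist a b)

  key≤ : ∀ a b → key a b ℕ.≤ suc (dist a b ℕ.+ dist a b)
  key≤ a b with touches-w? a b
  ... | yes _ = ℕₚ.n≤1+n _
  ... | no _  = ℕₚ.≤-refl

  key≥ : ∀ a b → dist a b ℕ.+ dist a b ℕ.≤ key a b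
  key≥ a b with touches-w? a b
  ... | yes _ = ℕₚ.≤-refl
  ... | no _  = ℕₚ.n≤1+n _

  key-touching : ∀ {a b} → a ≡ w ⊎ b ≡ w → key a b ≡ dist a b ℕ.+ dist a b
  key-touching {a} {b} touches with touches-w? a b
  ... | yes _ = refl
  ... | no ¬touches = ⊥-elim (¬touches touches)

  key-avoiding : ∀ {a b} → ¬ (a ≡ w ⊎ b ≡ w) → key a b ≡ suc (dist a b ℕ.+ dist a b)
  key-avoiding {a} {b} ¬touches with touches-w? a b
  ... | yes touches = ⊥-elim (¬touches touches)
  ... | no _ = refl

  key-< : ∀ {a b a′ b′} → dist a b ℕ.< dist a′ b′ → key a b ℕ.< key a′ b′
  key-< {a} {b} {a′} {b′} d<d′ = ℕₚ.<-≤-trans (s≤s (key≤ a b))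
    (ℕₚ.≤-trans (subst (ℕ._≤ dist a′ b′ ℕ.+ dist a′ b′) (cong suc (ℕₚ.+-suc (dist a b) (dist a b)))
                       (ℕₚ.+-mono-≤ d<d′ d<d′))
                (key≥ a′ b′))

  key-≤-touching : ∀ {a b a′ b′} → a ≡ w ⊎ b ≡ w → ¬ (a′ ≡ w ⊎ b′ ≡ w) → dist a b ℕ.≤ dist a′ b′ →
                   key a b ℕ.< key a′ b′
  key-≤-touching touches ¬touches′ d≤d′ rewrite key-touching touches | key-avoiding ¬touches′ =
    s≤s (ℕₚ.+-mono-≤ d≤d′ d≤d′)

  private
    through-rank-via-w : ∀ {a b a′ b′} x → x ∈ path a′ b′ → x ≢ w → x ≢ u → a′ ≢ u → b′ ≢ u → Meets a′ b′ →
      a ≡ w ⊎ b ≡ w → dist a b ≡ dist w x → (Unordered w x a′ b′ → (a , b) ≡ (a′ , b′)) →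
      (a , b) ≡ (a′ , b′) ⊎ key a b ℕ.< key a′ b′
    through-rank-via-w {a′ = a′} {b′} x x∈ x≢w x≢u a′≢u b′≢u meets touches d≡ ends with w ∈? path a′ b′
    ... | yes w∈ with dist-< w∈ x∈ (x≢w ∘ sym)
    ...   | inj₁ d<    = inj₂ (key-< (subst (ℕ._< _) (sym d≡) d<))
    ...   | inj₂ ends′ = inj₁ (ends ends′)
    through-rank-via-w {a′ = a′} {b′} x x∈ x≢w x≢u a′≢u b′≢u meets touches d≡ ends | no w∉ =
      inj₂ (key-≤-touching touches ¬touches′ (subst (ℕ._≤ _) (sym d≡) (ℕₚ.≤-trans (dist-adj x adj-wu) dist-ux<)))
      where
        ¬touches′ : ¬ (a′ ≡ w ⊎ b′ ≡ w)
        ¬touches′ (inj₁ refl) = w∉ (start∈path a′ b′)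
        ¬touches′ (inj₂ refl) = w∉ (end∈path a′ b′)
        u∈ : u ∈ path a′ b′
        u∈ = [ (λ u∈ → u∈) , (λ w∈ → ⊥-elim (w∉ w∈)) ]′ meets
        dist-ux< : dist u x ℕ.< dist a′ b′
        dist-ux< with dist-< u∈ x∈ (x≢u ∘ sym)
        ... | inj₁ d<                 = d<
        ... | inj₂ (inj₁ (u≡a′ , _)) = ⊥-elim (a′≢u (sym u≡a′))
        ... | inj₂ (inj₂ (u≡b′ , _)) = ⊥-elim (b′≢u (sym u≡b′))

  through-rank : ∀ {a b a′ b′} → a Fin.< b → a′ Fin.< b′ → a ≢ u → b ≢ u → a′ ≢ u → b′ ≢ u →
                 Through.Joined a′ b′ a b → (a , b) ≡ (a′ , b′) ⊎ key a b ℕ.< key a′ b′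
  through-rank a<b a′<b′ a≢u b≢u a′≢u b′≢u (inj₁ (a∈ , b∈)) with dist-< a∈ b∈ (λ a≡b → Finₚ.<-irrefl a≡b a<b)
  ... | inj₁ d<   = inj₂ (key-< d<)
  ... | inj₂ ends = inj₁ (unordered-≡ a<b a′<b′ ends)
  through-rank {b = b} a<b a′<b′ a≢u b≢u a′≢u b′≢u (inj₂ (inj₁ (refl , b∈) , meets)) =
    through-rank-via-w b b∈ (λ b≡w → Finₚ.<-irrefl (sym b≡w) a<b) b≢u a′≢u b′≢u meets (inj₁ refl) refl
      (unordered-≡ a<b a′<b′)
  through-rank {a = a} a<b a′<b′ a≢u b≢u a′≢u b′≢u (inj₂ (inj₂ (a∈ , refl) , meets)) =
    through-rank-via-w a a∈ (λ a≡w → Finₚ.<-irrefl a≡w a<b) a≢u a′≢u b′≢u meets (inj₂ refl) (dist-sym a _)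
      (unordered-≡ a<b a′<b′ ∘ unordered-swap)

  on-path-uv : ∀ {c} → c ∈ path u v → c ≢ u → c ≢ w → c ≡ v
  on-path-uv c∈ c≢u c≢w with subst (_ ∈_) (sym (path-unique uwv)) c∈
  ... | here c≡u                 = ⊥-elim (c≢u c≡u)
  ... | there (here c≡w)         = ⊥-elim (c≢w c≡w)
  ... | there (there (here c≡v)) = c≡v

  from-key : Fin n → ℕ
  from-key c with c Fin.≟ v
  ... | yes _ = 0
  ... | no _  = dist u c

  from-rank : ∀ {c c′} → c ≢ c′ → c ≢ u → c ≢ w → c′ ≢ u → c ≡ v ⊎ c ∈ path u c′ → from-key c ℕ.< from-key c′
  from-rank {c} {c′} c≢c′ c≢u c≢w c′≢u joined with c Fin.≟ v | c′ Fin.≟ v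
  ... | _       | yes refl = ⊥-elim (c≢c′ ([ (λ c≡v → c≡v) , (λ c∈ → on-path-uv c∈ c≢u c≢w) ]′ joined))
  ... | yes _   | no _     = dist>0 u c′
  ... | no c≢v  | no _     with joined
  ...   | inj₁ c≡v = ⊥-elim (c≢v c≡v)
  ...   | inj₂ c∈ with dist-< (start∈path u c′) c∈ (c≢u ∘ sym)
  ...     | inj₁ d<                 = d<
  ...     | inj₂ (inj₁ (_ , c≡c′))  = ⊥-elim (c≢c′ c≡c′)
  ...     | inj₂ (inj₂ (u≡c′ , _))  = ⊥-elim (c′≢u (sym u≡c′))

  data Kind (a b : Fin n) : Set where
    uw-pair    : Unordered a b u w → Kind a b
    avoiding-u : a ≢ u → b ≢ u → Kind a b
    at-u       : ∀ c → c ≢ u → c ≢ w → Unordered a b u c → Kind a b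

  kind : ∀ a b → a ≢ b → Kind a b
  kind a b a≢b with a Fin.≟ u | b Fin.≟ u
  ... | yes refl | yes refl = ⊥-elim (a≢b refl)
  ... | no a≢u   | no b≢u   = avoiding-u a≢u b≢u
  ... | yes refl | no b≢u with b Fin.≟ w
  ...   | yes refl = uw-pair (inj₁ (refl , refl))
  ...   | no b≢w   = at-u b b≢u b≢w (inj₁ (refl , refl))
  kind a b a≢b | no a≢u | yes refl with a Fin.≟ w
  ...   | yes refl = uw-pair (inj₂ (refl , refl))
  ...   | no a≢w   = at-u a a≢u a≢w (inj₂ (refl , refl))

  point : ∀ {a b} → Kind a b → Decomposition T
  point (uw-pair _)              = D-uw
  point {a} {b} (avoiding-u _ _) = Through.D a b (meets? a b)
  point (at-u c _ _ _)           = From.D c (w ∈? path u c)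

  test : ∀ {a b} → Kind a b → QVec n → ℚ
  test (uw-pair _)              x = 1ℚ
  test {a} {b} (avoiding-u _ _) x = 1ℚ - x a b
  test (at-u c _ _ _)           x = x w c - x u c

  point-on-face : ∀ {a b} (k : Kind a b) → excess (χ (point k)) u w v ≡ 0ℚ
  point-on-face (uw-pair _)              = excess-χ-joined D-uw {u} {w} v D-uw-joins
  point-on-face {a} {b} (avoiding-u _ _) =
    excess-χ-joined (Through.D a b (meets? a b)) {u} {w} v (Through.joins-uw a b (meets? a b))
  point-on-face (at-u c _ _ _)           = From.on-face c (w ∈? path u c)

  test-point≢0 : ∀ {a b} (k : Kind a b) → test k (χ (point k)) ≢ 0ℚ
  test-point≢0 (uw-pair _) ()
  test-point≢0 {a} {b} (avoiding-u _ _)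
    rewrite χ≡0 (Through.D a b (meets? a b)) {a} {b} (Through.joins-ab a b (meets? a b)) = λ ()
  test-point≢0 (at-u c c≢u c≢w _) = From.test≢0 c (w ∈? path u c) c≢u c≢w

  χ-difference≢0⇒joined : ∀ (D : Decomposition T) c → χ D w c - χ D u c ≢ 0ℚ →
                           label D u ≡ label D c ⊎ label D w ≡ label D c
  χ-difference≢0⇒joined D c test≢0 with label D u Fin.≟ label D c | label D w Fin.≟ label D c
  ... | yes u~c | _       = inj₁ u~c
  ... | no _    | yes w~c = inj₂ w~c
  ... | no _    | no _    = ⊥-elim (test≢0 refl)

  χ-difference≡0 : ∀ (D : Decomposition T) c → label D u ≡ label D w → χ D w c - χ D u c ≡ 0ℚ
  χ-difference≡0 D c u~w = trans (cong (λ t → χ D w c - t) (χ-resp-label D c u~w)) (ℚₚ.+-inverseʳ (χ D w c))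

  open Pairs n

  key-bound : ℕ
  key-bound = max[ #pairs ] (λ i → key (proj₁ (pair i)) (proj₂ (pair i)))

  rank : ∀ {a b} → Kind a b → ℕ
  rank (uw-pair _)              = 0
  rank {a} {b} (avoiding-u _ _) = suc (key a b)
  rank (at-u c _ _ _)           = suc (suc (key-bound ℕ.+ from-key c))

  triangular-kind : ∀ {a b a′ b′} (k : Kind a b) (k′ : Kind a′ b′) → a Fin.< b → a′ Fin.< b′ →
                    key a b ℕ.≤ key-bound → test k (χ (point k′)) ≢ 0ℚ → (a , b) ≡ (a′ , b′) ⊎ rank k ℕ.< rank k′
  triangular-kind (uw-pair ab) (uw-pair a′b′) a<b a′<b′ _ _ = inj₁ (unordered-≡ a<b a′<b′ (unordered-trans ab a′b′))
  triangular-kind (uw-pair _) (avoiding-u _ _) _ _ _ _ = inj₂ (s≤s z≤n)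
  triangular-kind (uw-pair _) (at-u _ _ _ _)   _ _ _ _ = inj₂ (s≤s z≤n)
  triangular-kind {a} {b} (avoiding-u a≢u b≢u) (uw-pair _) a<b _ _ test≢0 =
    ⊥-elim (D-uw-joins-only-uw (1-χ≢0⇒joined D-uw a b test≢0) (λ a≡b → Finₚ.<-irrefl a≡b a<b) a≢u b≢u)
  triangular-kind {a} {b} {a′} {b′} (avoiding-u a≢u b≢u) (avoiding-u a′≢u b′≢u) a<b a′<b′ _ test≢0 =
    ⊎.map₂ s≤s (through-rank a<b a′<b′ a≢u b≢u a′≢u b′≢u
      (Through.joined a′ b′ (meets? a′ b′) (1-χ≢0⇒joined (Through.D a′ b′ (meets? a′ b′)) a b test≢0)
                      (λ a≡b → Finₚ.<-irrefl a≡b a<b) a≢u b≢u))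
  triangular-kind (avoiding-u _ _) (at-u _ _ _ _) _ _ key≤ _ =
    inj₂ (s≤s (s≤s (ℕₚ.≤-trans key≤ (ℕₚ.m≤m+n key-bound _))))
  triangular-kind (at-u c _ _ _) (uw-pair _) _ _ _ test≢0 = ⊥-elim (test≢0 (χ-difference≡0 D-uw c D-uw-joins))
  triangular-kind {a′ = a′} {b′} (at-u c _ _ _) (avoiding-u _ _) _ _ _ test≢0 =
    ⊥-elim (test≢0 (χ-difference≡0 (Through.D a′ b′ (meets? a′ b′)) c (Through.joins-uw a′ b′ (meets? a′ b′))))
  triangular-kind (at-u c c≢u c≢w abuc) (at-u c′ c′≢u _ a′b′uc′) a<b a′<b′ _ test≢0 with c Fin.≟ c′
  ... | yes refl = inj₁ (unordered-≡ a<b a′<b′ (unordered-trans abuc a′b′uc′))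
  ... | no c≢c′  = inj₂ (s≤s (s≤s (ℕₚ.+-monoʳ-< key-bound (from-rank c≢c′ c≢u c≢w c′≢u
                     (From.joined c′ (w ∈? path u c′) c≢u c≢w
                        (χ-difference≢0⇒joined (From.D c′ (w ∈? path u c′)) c test≢0))))))

  test-combination≡0 : ∀ {a b} (k : Kind a b) {K} (z : Fin K → QVec n) (μ : Fin K → ℚ) → Σ[ K ] μ ≡ 0ℚ →
    (∀ a b → Σ[ K ] (λ j → μ j * z j a b) ≡ 0ℚ) → Σ[ K ] (λ j → μ j * test k (z j)) ≡ 0ℚ
  test-combination≡0 (uw-pair _) {K} z μ Σμ≡0 _ = trans (Σ-cong K (λ j → ℚₚ.*-identityʳ (μ j))) Σμ≡0
  test-combination≡0 {a} {b} (avoiding-u _ _) {K} z μ Σμ≡0 combination≡0 =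
    trans (Σ-*-- K μ (λ _ → 1ℚ) (λ j → z j a b))
          (cong₂ _-_ (trans (Σ-cong K (λ j → ℚₚ.*-identityʳ (μ j))) Σμ≡0) (combination≡0 a b))
  test-combination≡0 (at-u c _ _ _) {K} z μ _ combination≡0 =
    trans (Σ-*-- K μ (λ j → z j w c) (λ j → z j u c)) (cong₂ _-_ (combination≡0 w c) (combination≡0 u c))

  kind-of : (i : Fin #pairs) → Kind (proj₁ (pair i)) (proj₂ (pair i))
  kind-of i = kind _ _ (λ e → Finₚ.<-irrefl e (pair-< i))

  face-point : Fin #pairs → QVec n
  face-point i = χ (point (kind-of i))

  face-independent : AffIndep face-point
  face-independent μ Σμ≡0 combination≡0 =
    triangular⇒trivial #pairs (λ i j → test (kind-of i) (face-point j)) (rank ∘ kind-of)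
      (test-point≢0 ∘ kind-of) triangular μ (λ i → test-combination≡0 (kind-of i) face-point μ Σμ≡0 combination≡0)
    where
      triangular : ∀ i j → test (kind-of i) (face-point j) ≢ 0ℚ → j ≡ i ⊎ rank (kind-of i) ℕ.< rank (kind-of j)
      triangular i j test≢0 with triangular-kind (kind-of i) (kind-of j) (pair-< i) (pair-< j)
                                   (≤max #pairs (λ i → key (proj₁ (pair i)) (proj₂ (pair i))) i) test≢0
      ... | inj₁ pair≡ = inj₁ (sym (pair-injective i j pair≡))
      ... | inj₂ <rank = inj₂ <rank

  facet : DefinesFacet (InLMC T) (λ x → excess x u w v) 0ℚ
  facet = (λ x x∈ → LMC-excess≤0 x∈ u w v) , #pairs ,
          ((χ singletons ∷ᶠ face-point , points∈LMC ,
            AffIndep-∷ {y = face-point} u w v singletons-off (point-on-face ∘ kind-of) face-independent)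
          , LMC-¬AffIndep) ,
          ((face-point , (λ i → χ∈LMC (point (kind-of i)) , point-on-face (kind-of i)) , face-independent)
          , face-¬AffIndep u≢v u≢w w≢v)
    where
      points∈LMC : ∀ i → InLMC T ((χ singletons ∷ᶠ face-point) i)
      points∈LMC zero    = χ∈LMC singletons
      points∈LMC (suc i) = χ∈LMC (point (kind-of i))
      singletons-off : excess (χ singletons) u w v ≢ 0ℚ
      singletons-off = -1≢0 ∘ trans (sym (excess-χ-apart singletons u≢w w≢v u≢v))

proposition6p6 : ∀ (n : ℕ) (T : Graph n) → IsTree T →
    ∀ (u v w : Fin n) (ys : List (Fin n)) →
    IsPath T u v (u ∷ w ∷ ys) → ys ≢ [] →
    DefinesFacet (InLMC T) (λ x → x u v - (x u w + x w v)) 0ℚ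
      ⇔ (length ys ≡ 1)
proposition6p6 n T tree u v w []            p ys≢[] = ⊥-elim (ys≢[] refl)
proposition6p6 n T tree u v w (y ∷ [])      p _     =
  mk⇔ (λ _ → refl) (λ _ → DistanceTwo.facet tree (subst (λ t → IsPath T u v (u ∷ w ∷ t ∷ [])) y≡v p))
  where
    y≡v : y ≡ v
    y≡v = Last-functional (Last-snoc (u ∷ w ∷ [])) (IsPath.end p)
proposition6p6 n T tree u v w (w₂ ∷ y ∷ ys) p _     = mk⇔ (⊥-elim ∘ distance≥3⇒¬facet tree p) (λ ())
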